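{- Let $p$ be a prime and $a$ a positive integer. Then $g\big(\frac{p^{4a}+p^{3a}+p^{2a}+p^a+1}{5},p^{5a}\big)=5$ if $p\equiv1\pmod5$; $g\big(\frac{p^{8a}+p^{6a}+p^{4a}+p^{2a}+1}{5},p^{10a}\big)=5$ if $p\equiv4\pmod5$; $g\big(\frac{p^{16a}+p^{12a}+p^{8a}+p^{4a}+1}{5},p^{20a}\big)=5$ if $p\equiv2,3\pmod5$.
   Context: For a prime power $q$ and a positive integer $k\mid q-1$, the Waring number $g(k,q)$ is the least positive integer $s$ such that every element of $\mathbb{F}_q$ can be written as $x_1^k+\cdots+x_s^k$ with $x_i\in\mathbb{F}_q$ (if such $s$ exists). -}

module Defs where

open import Level using (Level; _⊔_; suc)
open import Data.Nat as ℕ using (ℕ; zero; _<_; _≤_) renaming (suc to sucℕ)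
open import Data.Fin using (Fin) renaming (zero to fzero; suc to fsuc)
open import Data.Product using (Σ; ∃; _×_)
open import Relation.Nullary using (¬_)
open import Relation.Binary.PropositionalEquality using (_≡_)
open import Algebra.Bundles using (CommutativeRing; Semiring)
import Algebra.Definitions.RawSemiring as RS

record FiniteField (c ℓ : Level) : Set (suc (c ⊔ ℓ)) where
  field
    commRing : CommutativeRing c ℓ
  open CommutativeRing commRing public
  field
    1≉0     : ¬ (1# ≈ 0#)
    inverse : ∀ x → ¬ (x ≈ 0#) → ∃ λ y → x * y ≈ 1#
    size    : ℕ
    enum    : Fin size → Carrier
    enum-surj : ∀ x → ∃ λ i → enum i ≈ x
    enum-inj  : ∀ i j → enum i ≈ enum j → i ≡ j

module _ {c ℓ : Level} (F : FiniteField c ℓ) where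
  open FiniteField F
  open RS (Semiring.rawSemiring semiring) using (_^_)

  sumF : (s : ℕ) → (Fin s → Carrier) → Carrier
  sumF zero     xs = 0#
  sumF (sucℕ s) xs = xs fzero + sumF s (λ i → xs (fsuc i))

  WaringRep : ℕ → ℕ → Set (c ⊔ ℓ)
  WaringRep k s = ∀ (y : Carrier) → ∃ λ (xs : Fin s → Carrier) → sumF s (λ i → xs i ^ k) ≈ y

  -- g(k, |F|) = s : s is the least positive integer with WaringRep k s
  WaringNumberIs : ℕ → ℕ → Set (c ⊔ ℓ)
  WaringNumberIs k s = (1 ≤ s) × WaringRep k s × (∀ t → 1 ≤ t → t < s → ¬ WaringRep k t)

module Submission where

-- Let Q = p ^ e ≡ 1 (mod 5), |F| = Q ^ 5 and k = Φ₅(Q) / 5, so that |F×| = 5(Q − 1) · k.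
-- The Frobenius σ y = y ^ Q is a ring automorphism of order 5 fixing the fifth roots of
-- unity, and for a primitive fifth root ζ the Lagrange resolvents Σᵢ ζ^(−ij) σⁱ y split
-- every y into five σ-eigenvectors with eigenvalues ζ ^ j (5 is invertible because
-- Q ≡ 1 mod 5).  A nonzero element is a k-th power exactly when it is such an eigenvector:
-- x ^ k has eigenvalue x ^ (k(Q − 1)), a fifth root of unity.  Hence every element is a
-- sum of five k-th powers.  Conversely a sum of fewer than five eigenvectors has, by
-- pigeonhole, some vanishing resolvent, whereas w = Σ_{i<5} ω ^ i with σ ω = ζ ω has all
-- five resolvents nonzero.

open import Level using (Level)
open import Data.Bool using (T)
open import Data.Empty using (⊥; ⊥-elim)
open import Data.Fin as Fin using (Fin; toℕ; fromℕ; inject₁) renaming (zero to fzero; suc to fsuc)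
import Data.Fin.Properties as FinP
open import Data.Integer as ℤ using (ℤ; +_; -[1+_]; _⊖_; sign; ∣_∣; _◃_)
import Data.Integer.Properties as ℤP
open import Data.List using (List; []; _∷_; length; foldr; map; filter; tabulate)
import Data.List.Properties as ListP
open import Data.List.Relation.Unary.All as All using (All; []; _∷_)
import Data.List.Relation.Unary.All.Properties as AllP
open import Data.List.Relation.Unary.AllPairs using ([]; _∷_)
open import Data.List.Relation.Unary.Any as Any using (Any; here; there; any?)
import Data.List.Relation.Unary.Unique.Setoid as UniqueSetoid
import Data.List.Relation.Unary.Unique.Setoid.Properties as UniqueP
import Data.List.Membership.Setoid as MembershipSetoid
import Data.List.Membership.Setoid.Properties as MembershipP
open import Data.Maybe using (Maybe; just; nothing)
open import Data.Nat as ℕ using (ℕ; zero; suc; _!)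
import Data.Nat.Properties as ℕP
open import Data.Nat.Combinatorics using (_C_; nCk≡n!/k![n-k]!; k![n∸k]!∣n!; nCn≡1)
open import Data.Nat.Divisibility using (_∣_; divides; m∣m*n; ∣⇒≤)
open import Data.Nat.DivMod using (_/_; _%_; m≡m%n+[m/n]*n; %-distribˡ-*; m%n%n≡m%n; m/n*n≡m; m*[n/m]≡n)
open import Data.Nat.ListAction using () renaming (sum to sumℕ)
open import Data.Nat.Primality using (Prime; euclidsLemma; prime⇒nonTrivial; prime⇒nonZero)
open import Data.Nat.Solver using (module +-*-Solver)
open import Data.Product using (Σ; ∃₂; _×_; _,_; proj₁; proj₂)
open import Data.Sign as Sign using (Sign)
open import Data.Sum using (_⊎_; inj₁; inj₂; [_,_])
open import Function using (_∘_)
open import Relation.Nullary using (¬_; Dec; yes; no; ¬?; _×-dec_)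
open import Relation.Nullary.Decidable using (decidable-stable)
import Relation.Binary as B
open import Relation.Binary.Definitions using (Decidable)
open import Relation.Binary.PropositionalEquality as ≡ using (_≡_; _≢_)
open import Algebra.Bundles using (CommutativeRing; CommutativeMonoid)
import Algebra.Solver.Ring.AlmostCommutativeRing as ACR
open import Defs

prime≥2 : ∀ {p} → Prime p → 2 ℕ.≤ p
prime≥2 {p} p-prime = ℕ.nonTrivial⇒n>1 p {{prime⇒nonTrivial p-prime}}

prime∤! : ∀ {p} → Prime p → ∀ m → m ℕ.< p → ¬ p ∣ m !
prime∤! p-prime zero    _   p∣1 = ℕP.<⇒≱ (prime≥2 p-prime) (∣⇒≤ p∣1)
prime∤! p-prime (suc m) m<p p∣m! with euclidsLemma (suc m) (m !) p-prime p∣m!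
... | inj₁ p∣1+m = ℕP.<⇒≱ m<p (∣⇒≤ p∣1+m)
... | inj₂ p∣m!  = prime∤! p-prime m (ℕP.<-trans (ℕP.n<1+n m) m<p) p∣m!

prime∣C : ∀ {p} → Prime p → ∀ k → 0 ℕ.< k → k ℕ.< p → p ∣ p C k
prime∣C {p} p-prime k 0<k k<p with euclidsLemma (p C k) (k ! ℕ.* (p ℕ.∸ k) !) p-prime (≡.subst (p ∣_) (≡.sym C*k![p∸k]!≡p!) p∣p!)
  where
  C*k![p∸k]!≡p! : (p C k) ℕ.* (k ! ℕ.* (p ℕ.∸ k) !) ≡ p !
  C*k![p∸k]!≡p! = ≡.trans (≡.cong (ℕ._* (k ! ℕ.* (p ℕ.∸ k) !)) (nCk≡n!/k![n-k]! (ℕP.<⇒≤ k<p)))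
    (m/n*n≡m {{ℕP._!*_!≢0 k (p ℕ.∸ k)}} (k![n∸k]!∣n! (ℕP.<⇒≤ k<p)))
  p∣p! : p ∣ p !
  p∣p! = ≡.subst (λ n → n ∣ n !) (ℕP.suc-pred p {{prime⇒nonZero p-prime}}) (m∣m*n (ℕ.pred p !))
... | inj₁ p∣C = p∣C
... | inj₂ p∣k!*[p∸k]! with euclidsLemma (k !) ((p ℕ.∸ k) !) p-prime p∣k!*[p∸k]!
...   | inj₁ p∣k!     = ⊥-elim (prime∤! p-prime k k<p p∣k!)
...   | inj₂ p∣[p∸k]! = ⊥-elim (prime∤! p-prime (p ℕ.∸ k) (ℕP.∸-monoʳ-< 0<k (ℕP.<⇒≤ k<p)) p∣[p∸k]!)

Φ₅ℕ : ℕ → ℕ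
Φ₅ℕ q = q ℕ.^ 4 ℕ.+ q ℕ.^ 3 ℕ.+ q ℕ.^ 2 ℕ.+ q ℕ.+ 1

^5≡1+k*5t*5 : ∀ {q t k} → q ≡ suc (5 ℕ.* t) → 5 ℕ.* k ≡ Φ₅ℕ q → q ℕ.^ 5 ≡ suc (k ℕ.* (5 ℕ.* t) ℕ.* 5)
^5≡1+k*5t*5 {t = t} {k} ≡.refl 5k≡Φ₅ℕq = begin
  suc (5 ℕ.* t) ℕ.^ 5
    ≡⟨ solve 1 (λ t → (con 1 :+ con 5 :* t) :^ 5 := con 1 :+ con 5 :* t :* Φ (con 1 :+ con 5 :* t)) ≡.refl t ⟩
  suc (5 ℕ.* t ℕ.* Φ₅ℕ (suc (5 ℕ.* t)))
    ≡⟨ ≡.cong (λ m → suc (5 ℕ.* t ℕ.* m)) 5k≡Φ₅ℕq ⟨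
  suc (5 ℕ.* t ℕ.* (5 ℕ.* k))
    ≡⟨ ≡.cong suc (solve 2 (λ t k → con 5 :* t :* (con 5 :* k) := k :* (con 5 :* t) :* con 5) ≡.refl t k) ⟩
  suc (k ℕ.* (5 ℕ.* t) ℕ.* 5)
    ∎
  where
  open ≡.≡-Reasoning
  open +-*-Solver
  Φ : ∀ {n} → Polynomial n → Polynomial n
  Φ q = q :^ 4 :+ q :^ 3 :+ q :^ 2 :+ q :+ con 1

^-%-congˡ : ∀ m d n .{{_ : ℕ.NonZero n}} → (m ℕ.^ d) % n ≡ ((m % n) ℕ.^ d) % n
^-%-congˡ m zero    n = ≡.refl
^-%-congˡ m (suc d) n = begin
  (m ℕ.* m ℕ.^ d) % n                          ≡⟨ %-distribˡ-* m (m ℕ.^ d) n ⟩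
  ((m % n) ℕ.* ((m ℕ.^ d) % n)) % n            ≡⟨ ≡.cong (λ x → ((m % n) ℕ.* x) % n) (^-%-congˡ m d n) ⟩
  ((m % n) ℕ.* (((m % n) ℕ.^ d) % n)) % n      ≡⟨ ≡.cong (λ x → (x ℕ.* (((m % n) ℕ.^ d) % n)) % n) (m%n%n≡m%n m n) ⟨
  (((m % n) % n) ℕ.* (((m % n) ℕ.^ d) % n)) % n ≡⟨ %-distribˡ-* (m % n) ((m % n) ℕ.^ d) n ⟨
  ((m % n) ℕ.* (m % n) ℕ.^ d) % n              ∎
  where open ≡.≡-Reasoning

%5≡1⇒^%5≡1 : ∀ m d → m % 5 ≡ 1 → (m ℕ.^ d) % 5 ≡ 1
%5≡1⇒^%5≡1 m d m%5≡1 = ≡.trans (^-%-congˡ m d 5) (≡.trans (≡.cong (λ r → (r ℕ.^ d) % 5) m%5≡1) (≡.cong (_% 5) (ℕP.^-zeroˡ d)))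

%5≡1⇒≡1+5*[/5] : ∀ m → m % 5 ≡ 1 → m ≡ suc (5 ℕ.* (m / 5))
%5≡1⇒≡1+5*[/5] m m%5≡1 = ≡.trans (m≡m%n+[m/n]*n m 5) (≡.cong₂ ℕ._+_ m%5≡1 (ℕP.*-comm (m / 5) 5))

5∣Φ₅ℕ : ∀ q → q % 5 ≡ 1 → 5 ∣ Φ₅ℕ q
5∣Φ₅ℕ q q%5≡1 = divides (125 ℕ.* t ℕ.^ 4 ℕ.+ 125 ℕ.* t ℕ.^ 3 ℕ.+ 50 ℕ.* t ℕ.^ 2 ℕ.+ 10 ℕ.* t ℕ.+ 1)
  (≡.trans (≡.cong Φ₅ℕ (%5≡1⇒≡1+5*[/5] q q%5≡1)) (solve 1 (λ t → Φ (con 1 :+ con 5 :* t)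
     := (con 125 :* t :^ 4 :+ con 125 :* t :^ 3 :+ con 50 :* t :^ 2 :+ con 10 :* t :+ con 1) :* con 5) ≡.refl t))
  where
  open +-*-Solver
  t : ℕ
  t = q / 5
  Φ : ∀ {n} → Polynomial n → Polynomial n
  Φ q = q :^ 4 :+ q :^ 3 :+ q :^ 2 :+ q :+ con 1

pigeonhole-column : ∀ {p m n} → n ℕ.< m → (P : Fin n → Fin m → Set p) → (∀ i j → Dec (P i j)) →
                    (∀ i j j′ → ¬ P i j → ¬ P i j′ → j ≡ j′) → Σ (Fin m) λ j → ∀ i → P i j
pigeonhole-column {m = m} {n} n<m P P? unique-failure = decide (FinP.any? (λ j → FinP.all? (λ i → P? i j)))
  where
  decide : Dec (Σ (Fin m) λ j → ∀ i → P i j) → Σ (Fin m) λ j → ∀ i → P i j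
  decide (yes found) = found
  decide (no none)   = ⊥-elim (collision (FinP.pigeonhole n<m (proj₁ ∘ failure)))
    where
    failure : ∀ j → Σ (Fin n) λ i → ¬ P i j
    failure j = FinP.¬∀⟶∃¬ n (λ i → P i j) (λ i → P? i j) (λ all → none (j , all))
    collision : (∃₂ λ j j′ → j Fin.< j′ × proj₁ (failure j) ≡ proj₁ (failure j′)) → ⊥
    collision (j , j′ , j<j′ , same-row) = FinP.<⇒≢ j<j′ (unique-failure _ j j′ (proj₂ (failure j))
      (≡.subst (λ i → ¬ P i j′) (≡.sym same-row) (proj₂ (failure j′))))

-- The ring solver needs a coefficient ring mapped into R; ℤ maps into every commutative
-- ring.  The type-checking-optimised multiplication makes ⟦ + 1 ⟧ reduce to 1#, so solver
-- goals match terms written with 1#.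
module IntegerCoefficientSolver {c ℓ : Level} (R : CommutativeRing c ℓ) where
  open CommutativeRing R
  open import Algebra.Properties.Semiring.Mult.TCOptimised semiring using (×-homo-+; ×1-homo-*) renaming (_×_ to _·_)
  open import Algebra.Properties.Ring ring using (-‿distribˡ-*; -‿distribʳ-*; -0#≈0#; -‿involutive; -‿+-comm)
  open import Relation.Binary.Reasoning.Setoid setoid

  signed : Sign → Carrier → Carrier
  signed Sign.+ x = x
  signed Sign.- x = - x

  signed-cong : ∀ s {x y} → x ≈ y → signed s x ≈ signed s y
  signed-cong Sign.+ x≈y = x≈y
  signed-cong Sign.- x≈y = -‿cong x≈y

  signed-* : ∀ s t x y → signed (s Sign.* t) (x * y) ≈ signed s x * signed t y
  signed-* Sign.+ Sign.+ x y = refl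
  signed-* Sign.+ Sign.- x y = -‿distribʳ-* x y
  signed-* Sign.- Sign.+ x y = -‿distribˡ-* x y
  signed-* Sign.- Sign.- x y = begin
    x * y             ≈⟨ -‿involutive (x * y) ⟨
    - - (x * y)       ≈⟨ -‿cong (-‿distribʳ-* x y) ⟩
    - (x * - y)       ≈⟨ -‿distribˡ-* x (- y) ⟩
    - x * - y         ∎

  ⟦_⟧ : ℤ → Carrier
  ⟦ i ⟧ = signed (sign i) (∣ i ∣ · 1#)

  ⟦◃⟧ : ∀ s n → ⟦ s ◃ n ⟧ ≈ signed s (n · 1#)
  ⟦◃⟧ Sign.+ zero    = refl
  ⟦◃⟧ Sign.- zero    = sym -0#≈0#
  ⟦◃⟧ Sign.+ (suc n) = refl
  ⟦◃⟧ Sign.- (suc n) = refl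

  ⟦⊖⟧ : ∀ m n → ⟦ m ⊖ n ⟧ ≈ m · 1# - n · 1#
  ⟦⊖⟧ m n with ℕP.≤-<-connex n m
  ... | inj₁ n≤m rewrite ℤP.⊖-≥ n≤m = begin
    (m ℕ.∸ n) · 1#                          ≈⟨ +-identityʳ _ ⟨
    (m ℕ.∸ n) · 1# + 0#                     ≈⟨ +-congˡ (-‿inverseʳ (n · 1#)) ⟨
    (m ℕ.∸ n) · 1# + (n · 1# - n · 1#)      ≈⟨ +-assoc _ _ _ ⟨
    ((m ℕ.∸ n) · 1# + n · 1#) - n · 1#      ≈⟨ +-congʳ (×-homo-+ 1# (m ℕ.∸ n) n) ⟨
    (m ℕ.∸ n ℕ.+ n) · 1# - n · 1#           ≡⟨ ≡.cong (λ k → k · 1# - n · 1#) (ℕP.m∸n+n≡m n≤m) ⟩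
    m · 1# - n · 1#                         ∎
  ... | inj₂ m<n rewrite ℤP.⊖-< m<n | ≡.sym (ℤP.-◃n≡-n (n ℕ.∸ m)) = begin
    ⟦ Sign.- ◃ (n ℕ.∸ m) ⟧                  ≈⟨ ⟦◃⟧ Sign.- (n ℕ.∸ m) ⟩
    - ((n ℕ.∸ m) · 1#)                      ≈⟨ +-identityˡ _ ⟨
    0# + - ((n ℕ.∸ m) · 1#)                 ≈⟨ +-congʳ (-‿inverseʳ (m · 1#)) ⟨
    (m · 1# - m · 1#) + - ((n ℕ.∸ m) · 1#)  ≈⟨ +-assoc _ _ _ ⟩
    m · 1# + (- (m · 1#) + - ((n ℕ.∸ m) · 1#)) ≈⟨ +-congˡ (-‿+-comm _ _) ⟩
    m · 1# - (m · 1# + (n ℕ.∸ m) · 1#)      ≈⟨ +-congˡ (-‿cong (×-homo-+ 1# m (n ℕ.∸ m))) ⟨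
    m · 1# - (m ℕ.+ (n ℕ.∸ m)) · 1#         ≡⟨ ≡.cong (λ k → m · 1# - k · 1#) (ℕP.m+[n∸m]≡n (ℕP.<⇒≤ m<n)) ⟩
    m · 1# - n · 1#                         ∎

  ⟦+⟧ : ∀ i j → ⟦ i ℤ.+ j ⟧ ≈ ⟦ i ⟧ + ⟦ j ⟧
  ⟦+⟧ -[1+ m ] -[1+ n ] = begin
    - (suc (suc (m ℕ.+ n)) · 1#)            ≡⟨ ≡.cong (λ k → - (suc k · 1#)) (ℕP.+-suc m n) ⟨
    - ((suc m ℕ.+ suc n) · 1#)              ≈⟨ -‿cong (×-homo-+ 1# (suc m) (suc n)) ⟩
    - (suc m · 1# + suc n · 1#)             ≈⟨ -‿+-comm _ _ ⟨
    - (suc m · 1#) + - (suc n · 1#)         ∎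
  ⟦+⟧ -[1+ m ] (+ n)    = trans (⟦⊖⟧ n (suc m)) (+-comm _ _)
  ⟦+⟧ (+ m)    -[1+ n ] = ⟦⊖⟧ m (suc n)
  ⟦+⟧ (+ m)    (+ n)    = ×-homo-+ 1# m n

  ⟦*⟧ : ∀ i j → ⟦ i ℤ.* j ⟧ ≈ ⟦ i ⟧ * ⟦ j ⟧
  ⟦*⟧ i j = begin
    ⟦ (sign i Sign.* sign j) ◃ (∣ i ∣ ℕ.* ∣ j ∣) ⟧               ≈⟨ ⟦◃⟧ (sign i Sign.* sign j) (∣ i ∣ ℕ.* ∣ j ∣) ⟩
    signed (sign i Sign.* sign j) ((∣ i ∣ ℕ.* ∣ j ∣) · 1#)        ≈⟨ signed-cong (sign i Sign.* sign j) (×1-homo-* ∣ i ∣ ∣ j ∣) ⟩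
    signed (sign i Sign.* sign j) ((∣ i ∣ · 1#) * (∣ j ∣ · 1#))   ≈⟨ signed-* (sign i) (sign j) _ _ ⟩
    ⟦ i ⟧ * ⟦ j ⟧                                                 ∎

  ⟦-⟧ : ∀ i → ⟦ ℤ.- i ⟧ ≈ - ⟦ i ⟧
  ⟦-⟧ -[1+ n ]    = sym (-‿involutive _)
  ⟦-⟧ (+ zero)    = sym -0#≈0#
  ⟦-⟧ (+ (suc n)) = refl

  homomorphism : ℤ.+-*-rawRing ACR.-Raw-AlmostCommutative⟶ ACR.fromCommutativeRing R
  homomorphism = record
    { ⟦_⟧ = ⟦_⟧ ; +-homo = ⟦+⟧ ; *-homo = ⟦*⟧ ; -‿homo = ⟦-⟧ ; 0-homo = refl ; 1-homo = refl }

  ⟦⟧-weaklyDecidable : ∀ i j → Maybe (⟦ i ⟧ ≈ ⟦ j ⟧)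
  ⟦⟧-weaklyDecidable i j with i ℤ.≟ j
  ... | yes ≡.refl = just refl
  ... | no _       = nothing

  open import Algebra.Solver.Ring ℤ.+-*-rawRing (ACR.fromCommutativeRing R) homomorphism ⟦⟧-weaklyDecidable public
    using (solve; _:=_; _:+_; _:*_; _:-_; :-_; _:^_; con)

module CommutativeMonoidFold {c ℓ : Level} (M : CommutativeMonoid c ℓ) where
  open CommutativeMonoid M
  open import Algebra.Definitions.RawMonoid rawMonoid using () renaming (_×_ to _·_)
  open MembershipSetoid setoid using (_∈_)
  open UniqueSetoid setoid using (Unique)
  open import Relation.Binary.Reasoning.Setoid setoid

  fold : List Carrier → Carrier
  fold = foldr _∙_ ε

  fold-extract : ∀ {x xs} → x ∈ xs → Σ (List Carrier) λ ys →
                 fold xs ≈ x ∙ fold ys × length xs ≡ suc (length ys) × (∀ {y} → y ∈ xs → ¬ y ≈ x → y ∈ ys)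
  fold-extract {xs = z ∷ zs} (here x≈z) = zs , ∙-congʳ (sym x≈z) , ≡.refl , keep
    where
    keep : ∀ {y} → y ∈ z ∷ zs → ¬ y ≈ _ → y ∈ zs
    keep (here y≈z)  y≉x = ⊥-elim (y≉x (trans y≈z (sym x≈z)))
    keep (there y∈zs) _  = y∈zs
  fold-extract {x} {z ∷ zs} (there x∈zs) with fold-extract x∈zs
  ... | ys , fold-zs , length-zs , keep = z ∷ ys , fold-z∷zs , ≡.cong suc length-zs , keep′
    where
    fold-z∷zs : z ∙ fold zs ≈ x ∙ (z ∙ fold ys)
    fold-z∷zs = begin
      z ∙ fold zs         ≈⟨ ∙-congˡ fold-zs ⟩
      z ∙ (x ∙ fold ys)   ≈⟨ assoc z x _ ⟨
      (z ∙ x) ∙ fold ys   ≈⟨ ∙-congʳ (comm z x) ⟩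
      (x ∙ z) ∙ fold ys   ≈⟨ assoc x z _ ⟩
      x ∙ (z ∙ fold ys)   ∎
    keep′ : ∀ {y} → y ∈ z ∷ zs → ¬ y ≈ x → y ∈ z ∷ ys
    keep′ (here y≈z)   _   = here y≈z
    keep′ (there y∈zs) y≉x = there (keep y∈zs y≉x)

  fold-unique-⊆ : ∀ {xs ys} → Unique xs → length xs ≡ length ys → All (_∈ ys) xs → fold xs ≈ fold ys
  fold-unique-⊆ {[]}     {[]} _ _ _ = refl
  fold-unique-⊆ {x ∷ xs} {ys} (x∉xs ∷ xs!) length-eq (x∈ys ∷ xs⊆ys) with fold-extract x∈ys
  ... | ys′ , fold-ys , length-ys , keep =
    trans (∙-congˡ (fold-unique-⊆ xs! (ℕP.suc-injective (≡.trans length-eq length-ys)) xs⊆ys′)) (sym fold-ys)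
    where
    xs⊆ys′ : All (_∈ ys′) xs
    xs⊆ys′ = All.zipWith (λ (x≉y , y∈ys) → keep y∈ys (x≉y ∘ sym)) (x∉xs , xs⊆ys)

  fold-map-∙ : ∀ x xs → fold (map (x ∙_) xs) ≈ (length xs · x) ∙ fold xs
  fold-map-∙ x []       = sym (identityˡ ε)
  fold-map-∙ x (y ∷ ys) = begin
    (x ∙ y) ∙ fold (map (x ∙_) ys)      ≈⟨ ∙-congˡ (fold-map-∙ x ys) ⟩
    (x ∙ y) ∙ ((length ys · x) ∙ fold ys) ≈⟨ assoc x y _ ⟩
    x ∙ (y ∙ ((length ys · x) ∙ fold ys)) ≈⟨ ∙-congˡ (assoc y _ _) ⟨
    x ∙ ((y ∙ (length ys · x)) ∙ fold ys) ≈⟨ ∙-congˡ (∙-congʳ (comm y _)) ⟩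
    x ∙ (((length ys · x) ∙ y) ∙ fold ys) ≈⟨ ∙-congˡ (assoc _ y _) ⟩
    x ∙ ((length ys · x) ∙ (y ∙ fold ys)) ≈⟨ assoc x _ _ ⟨
    (x ∙ (length ys · x)) ∙ (y ∙ fold ys) ∎

  fold-translation-invariant : ∀ {x xs} → Unique xs → (∀ {y z} → x ∙ y ≈ x ∙ z → y ≈ z) →
                               All (λ y → x ∙ y ∈ xs) xs → (length xs · x) ∙ fold xs ≈ fold xs
  fold-translation-invariant {x} {xs} xs! x∙-injective x∙xs⊆xs = begin
    (length xs · x) ∙ fold xs   ≈⟨ fold-map-∙ x xs ⟨
    fold (map (x ∙_) xs)        ≈⟨ fold-unique-⊆ (UniqueP.map⁺ setoid setoid x∙-injective xs!)
                                                   (ListP.length-map (x ∙_) xs) (AllP.map⁺ x∙xs⊆xs) ⟩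
    fold xs                     ∎

module PrimeCharacteristic {c ℓ : Level} (R : CommutativeRing c ℓ) where
  open CommutativeRing R
  open import Algebra.Properties.Semiring.Mult semiring using (×-assocˡ; ×-congʳ; ×-assoc-*) renaming (_×_ to _·_)
  open import Algebra.Properties.Semiring.Exp semiring using (_^_; ^-assocʳ; ^-congˡ)
  open import Algebra.Properties.Monoid.Sum +-monoid using (sum; sum-cong-≋; sum-replicate-zero; sum-init-last)
  open import Algebra.Properties.CommutativeSemiring.Binomial commutativeSemiring using (theorem; binomialTerm)
  open import Relation.Binary.Reasoning.Setoid setoid

  p∣n⇒n·x≈0 : ∀ {p} → p · 1# ≈ 0# → ∀ n x → p ∣ n → n · x ≈ 0#
  p∣n⇒n·x≈0 {p} p·1≈0 n x (divides d ≡.refl) = begin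
    (d ℕ.* p) · x   ≈⟨ ×-assocˡ x d p ⟨
    d · (p · x)     ≈⟨ ×-congʳ d p·x≈0 ⟩
    d · 0#          ≈⟨ ·0≈0 d ⟩
    0#              ∎
    where
    p·x≈0 : p · x ≈ 0#
    p·x≈0 = begin
      p · x           ≈⟨ ×-congʳ p (*-identityˡ x) ⟨
      p · (1# * x)    ≈⟨ ×-assoc-* p 1# x ⟨
      (p · 1#) * x    ≈⟨ *-congʳ p·1≈0 ⟩
      0# * x          ≈⟨ zeroˡ x ⟩
      0#              ∎
    ·0≈0 : ∀ d → d · 0# ≈ 0#
    ·0≈0 zero    = refl
    ·0≈0 (suc d) = trans (+-identityˡ _) (·0≈0 d)

  ^p-distrib-+ : ∀ {p} → Prime p → p · 1# ≈ 0# → ∀ x y → (x + y) ^ p ≈ x ^ p + y ^ p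
  ^p-distrib-+ {zero}  p-prime _ = ⊥-elim (ℕP.<⇒≱ (prime≥2 p-prime) ℕ.z≤n)
  ^p-distrib-+ {suc r} p-prime p·1≈0 x y = begin
    (x + y) ^ suc r                                            ≈⟨ theorem (suc r) x y ⟩
    t fzero + sum (t ∘ fsuc)                                   ≈⟨ +-congˡ (sum-init-last (t ∘ fsuc)) ⟩
    t fzero + (sum (t ∘ fsuc ∘ inject₁) + t (fsuc (fromℕ r)))
      ≈⟨ +-cong first (+-cong (trans (sum-cong-≋ interior) (sum-replicate-zero r)) last) ⟩
    y ^ suc r + (0# + x ^ suc r)                               ≈⟨ +-congˡ (+-identityˡ _) ⟩
    y ^ suc r + x ^ suc r                                      ≈⟨ +-comm _ _ ⟩
    x ^ suc r + y ^ suc r                                      ∎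
    where
    t : Fin (suc (suc r)) → Carrier
    t = binomialTerm x y (suc r)
    first : t fzero ≈ y ^ suc r
    first = trans (+-identityʳ _) (*-identityˡ _)
    interior : ∀ i → t (fsuc (inject₁ i)) ≈ 0#
    interior i = p∣n⇒n·x≈0 p·1≈0 _ _ (prime∣C p-prime (suc (toℕ (inject₁ i))) (ℕ.s≤s ℕ.z≤n)
                   (ℕ.s≤s (≡.subst (ℕ._< r) (≡.sym (FinP.toℕ-inject₁ i)) (FinP.toℕ<n i))))
    last : t (fsuc (fromℕ r)) ≈ x ^ suc r
    last rewrite FinP.toℕ-fromℕ r | nCn≡1 (suc r) | ℕP.n∸n≡0 r = trans (+-identityʳ _) (*-identityʳ _)

  ^pʲ-distrib-+ : ∀ {p} → Prime p → p · 1# ≈ 0# → ∀ j x y → (x + y) ^ (p ℕ.^ j) ≈ x ^ (p ℕ.^ j) + y ^ (p ℕ.^ j)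
  ^pʲ-distrib-+ {p} p-prime p·1≈0 zero    x y = trans (*-identityʳ _) (sym (+-cong (*-identityʳ x) (*-identityʳ y)))
  ^pʲ-distrib-+ {p} p-prime p·1≈0 (suc j) x y = begin
    (x + y) ^ (p ℕ.* p ℕ.^ j)                 ≈⟨ ^-assocʳ (x + y) p (p ℕ.^ j) ⟨
    ((x + y) ^ p) ^ (p ℕ.^ j)                 ≈⟨ ^-congˡ (p ℕ.^ j) (^p-distrib-+ p-prime p·1≈0 x y) ⟩
    (x ^ p + y ^ p) ^ (p ℕ.^ j)               ≈⟨ ^pʲ-distrib-+ p-prime p·1≈0 j (x ^ p) (y ^ p) ⟩
    (x ^ p) ^ (p ℕ.^ j) + (y ^ p) ^ (p ℕ.^ j) ≈⟨ +-cong (^-assocʳ x p (p ℕ.^ j)) (^-assocʳ y p (p ℕ.^ j)) ⟩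
    x ^ (p ℕ.* p ℕ.^ j) + y ^ (p ℕ.* p ℕ.^ j) ∎

module FiniteFieldProperties {c ℓ : Level} (F : FiniteField c ℓ) where
  open FiniteField F public
  open import Algebra.Properties.CommutativeSemiring.Exp commutativeSemiring public
  open import Algebra.Properties.Semiring.Mult semiring public using (×1-homo-*) renaming (_×_ to _·_)
  open MembershipSetoid setoid public using (_∈_)
  open UniqueSetoid setoid public using (Unique)
  open IntegerCoefficientSolver commRing public using (solve; _:=_; _:+_; _:*_; _:-_; :-_; _:^_; con)
  open import Relation.Binary.Reasoning.Setoid setoid

  infix 4 _≟_
  _≟_ : Decidable _≈_
  x ≟ y with enum-surj x | enum-surj y
  ... | i , i↦x | j , j↦y with i Fin.≟ j
  ... | yes ≡.refl = yes (trans (sym i↦x) j↦y)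
  ... | no i≢j     = no (λ x≈y → i≢j (enum-inj i j (trans i↦x (trans x≈y (sym j↦y)))))

  *-cancelˡ : ∀ {x y z} → x ≉ 0# → x * y ≈ x * z → y ≈ z
  *-cancelˡ {x} {y} {z} x≉0 xy≈xz with inverse x x≉0
  ... | x⁻¹ , xx⁻¹≈1 = begin
    y                 ≈⟨ *-identityˡ y ⟨
    1# * y            ≈⟨ *-congʳ xx⁻¹≈1 ⟨
    (x * x⁻¹) * y     ≈⟨ solve 3 (λ x y w → (x :* w) :* y := w :* (x :* y)) refl x y x⁻¹ ⟩
    x⁻¹ * (x * y)     ≈⟨ *-congˡ xy≈xz ⟩
    x⁻¹ * (x * z)     ≈⟨ solve 3 (λ x z w → w :* (x :* z) := (x :* w) :* z) refl x z x⁻¹ ⟩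
    (x * x⁻¹) * z     ≈⟨ *-congʳ xx⁻¹≈1 ⟩
    1# * z            ≈⟨ *-identityˡ z ⟩
    z                 ∎

  zero-product : ∀ {x y} → x * y ≈ 0# → x ≈ 0# ⊎ y ≈ 0#
  zero-product {x} {y} xy≈0 with x ≟ 0#
  ... | yes x≈0 = inj₁ x≈0
  ... | no x≉0  = inj₂ (*-cancelˡ x≉0 (trans xy≈0 (sym (zeroʳ x))))

  *-≉0 : ∀ {x y} → x ≉ 0# → y ≉ 0# → x * y ≉ 0#
  *-≉0 x≉0 y≉0 xy≈0 with zero-product xy≈0
  ... | inj₁ x≈0 = x≉0 x≈0
  ... | inj₂ y≈0 = y≉0 y≈0

  ^-≉0 : ∀ {x} n → x ≉ 0# → x ^ n ≉ 0#
  ^-≉0 zero    x≉0 = 1≉0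
  ^-≉0 (suc n) x≉0 = *-≉0 x≉0 (^-≉0 n x≉0)

  0^≈0 : ∀ {n} → 0 ℕ.< n → 0# ^ n ≈ 0#
  0^≈0 {suc n} _ = zeroˡ _

  1^ : ∀ n → 1# ^ n ≈ 1#
  1^ zero    = refl
  1^ (suc n) = trans (*-identityˡ _) (1^ n)

  ^-swap : ∀ x m n → (x ^ m) ^ n ≈ (x ^ n) ^ m
  ^-swap x m n = trans (^-assocʳ x m n) (trans (^-congʳ x (ℕP.*-comm m n)) (sym (^-assocʳ x n m)))

  elements : List Carrier
  elements = tabulate enum

  ∈-elements : ∀ x → x ∈ elements
  ∈-elements x with enum-surj x
  ... | i , i↦x = MembershipP.∈-resp-≈ setoid i↦x (MembershipP.∈-tabulate⁺ setoid i)

  elements-unique : Unique elements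
  elements-unique = UniqueP.tabulate⁺ setoid (enum-inj _ _)

  units : List Carrier
  units = filter (λ x → ¬? (x ≟ 0#)) elements

  ∈-units : ∀ {x} → x ≉ 0# → x ∈ units
  ∈-units {x} x≉0 = MembershipP.∈-filter⁺ setoid (λ x → ¬? (x ≟ 0#)) (λ x≈y x≉0 y≈0 → x≉0 (trans x≈y y≈0))
                                          (∈-elements x) x≉0

  units-≉0 : All (_≉ 0#) units
  units-≉0 = AllP.all-filter (λ x → ¬? (x ≟ 0#)) elements

  units-unique : Unique units
  units-unique = UniqueP.filter⁺ setoid (λ x → ¬? (x ≟ 0#)) elements-unique

  N : ℕ
  N = length units

  size≡1+N : size ≡ suc N
  size≡1+N = ≡.trans (≡.sym (ListP.length-tabulate enum)) (drop-zero elements-unique (∈-elements 0#))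
    where
    drop-zero : ∀ {xs} → Unique xs → 0# ∈ xs → length xs ≡ suc (length (filter (λ x → ¬? (x ≟ 0#)) xs))
    drop-zero {y ∷ ys} (y∉ys ∷ _) (here 0≈y) = ≡.cong suc (≡.sym (≡.cong length
      (≡.trans (ListP.filter-reject (λ x → ¬? (x ≟ 0#)) (λ y≉0 → y≉0 (sym 0≈y)))
               (ListP.filter-all (λ x → ¬? (x ≟ 0#)) (All.map (λ y≉z z≈0 → y≉z (trans (sym 0≈y) (sym z≈0))) y∉ys)))))
    drop-zero {y ∷ ys} (y∉ys ∷ ys!) (there 0∈ys) with y ≟ 0#
    ... | yes y≈0 = ⊥-elim (AllP.All¬⇒¬Any (All.map (λ y≉z 0≈z → y≉z (trans y≈0 0≈z)) y∉ys) 0∈ys)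
    ... | no _    = ≡.cong suc (drop-zero ys! 0∈ys)

  open CommutativeMonoidFold *-commutativeMonoid using () renaming (fold to product; fold-translation-invariant to product-translation-invariant)
  open CommutativeMonoidFold +-commutativeMonoid using () renaming (fold to sum; fold-translation-invariant to sum-translation-invariant)

  product-≉0 : ∀ {xs} → All (_≉ 0#) xs → product xs ≉ 0#
  product-≉0 []            = 1≉0
  product-≉0 (x≉0 ∷ xs≉0) = *-≉0 x≉0 (product-≉0 xs≉0)

  ^N≈1 : ∀ {x} → x ≉ 0# → x ^ N ≈ 1#
  ^N≈1 {x} x≉0 = *-cancelˡ (product-≉0 units-≉0) (begin
    product units * x ^ N   ≈⟨ *-comm _ _ ⟩
    x ^ N * product units   ≈⟨ product-translation-invariant units-unique (*-cancelˡ x≉0)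
                                 (All.map (λ y≉0 → ∈-units (*-≉0 x≉0 y≉0)) units-≉0) ⟩
    product units           ≈⟨ *-identityʳ _ ⟨
    product units * 1#      ∎)

  ^size≈id : ∀ x → x ^ size ≈ x
  ^size≈id x rewrite size≡1+N with x ≟ 0#
  ... | yes x≈0 = trans (*-congʳ x≈0) (trans (zeroˡ _) (sym x≈0))
  ... | no x≉0  = trans (*-congˡ (^N≈1 x≉0)) (*-identityʳ x)

  size·≈0 : ∀ x → size · x ≈ 0#
  size·≈0 x = begin
    size · x                                 ≡⟨ ≡.cong (_· x) (ListP.length-tabulate enum) ⟨
    length elements · x                      ≈⟨ solve 2 (λ a s → a := (a :+ s) :- s) refl _ (sum elements) ⟩
    (length elements · x + sum elements) - sum elements
      ≈⟨ +-congʳ (sum-translation-invariant elements-unique +-cancelˡ (All.tabulate (λ {y} _ → ∈-elements (x + y)))) ⟩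
    sum elements - sum elements              ≈⟨ -‿inverseʳ _ ⟩
    0#                                       ∎
    where
    +-cancelˡ : ∀ {y z} → x + y ≈ x + z → y ≈ z
    +-cancelˡ {y} {z} x+y≈x+z = begin
      y               ≈⟨ solve 2 (λ x y → y := (:- x) :+ (x :+ y)) refl x y ⟩
      - x + (x + y)   ≈⟨ +-congˡ x+y≈x+z ⟩
      - x + (x + z)   ≈⟨ solve 2 (λ x z → (:- x) :+ (x :+ z) := z) refl x z ⟩
      z               ∎

  ·1-homo-^ : ∀ p m → (p ℕ.^ m) · 1# ≈ (p · 1#) ^ m
  ·1-homo-^ p zero    = +-identityʳ 1#
  ·1-homo-^ p (suc m) = trans (×1-homo-* p (p ℕ.^ m)) (*-congˡ (·1-homo-^ p m))

  size≡p^m⇒p·1≈0 : ∀ {p m} → size ≡ p ℕ.^ m → p · 1# ≈ 0#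
  size≡p^m⇒p·1≈0 {p} {m} size≡p^m with p · 1# ≟ 0#
  ... | yes p≈0 = p≈0
  ... | no p≉0  = ⊥-elim (^-≉0 m p≉0 (begin
    (p · 1#) ^ m        ≈⟨ ·1-homo-^ p m ⟨
    (p ℕ.^ m) · 1#      ≡⟨ ≡.cong (_· 1#) size≡p^m ⟨
    size · 1#           ≈⟨ size·≈0 1# ⟩
    0#                  ∎))

module Polynomials {c ℓ : Level} (F : FiniteField c ℓ) where
  open FiniteFieldProperties F
  open import Relation.Binary.Reasoning.Setoid setoid

  eval : List Carrier → Carrier → Carrier
  eval []       x = 0#
  eval (a ∷ as) x = a + x * eval as x

  quotient : Carrier → List Carrier → List Carrier
  quotient r []       = []
  quotient r (b ∷ bs) = eval (b ∷ bs) r ∷ quotient r bs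

  length-quotient : ∀ r bs → length (quotient r bs) ≡ length bs
  length-quotient r []       = ≡.refl
  length-quotient r (b ∷ bs) = ≡.cong suc (length-quotient r bs)

  IsZero : List Carrier → Set (c Level.⊔ ℓ)
  IsZero = All (_≈ 0#)

  eval-IsZero : ∀ {f} → IsZero f → ∀ x → eval f x ≈ 0#
  eval-IsZero []              x = refl
  eval-IsZero (a≈0 ∷ as≈0) x = trans (+-cong a≈0 (trans (*-congˡ (eval-IsZero as≈0 x)) (zeroʳ x))) (+-identityʳ 0#)

  eval-division : ∀ a as r s → eval (a ∷ as) s ≈ eval (a ∷ as) r + (s - r) * eval (quotient r as) s
  eval-division a []       r s = solve 3 (λ a r s → a :+ s :* con (+ 0) := (a :+ r :* con (+ 0)) :+ (s :- r) :* con (+ 0)) refl a r s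
  eval-division a (b ∷ bs) r s = begin
    a + s * eval (b ∷ bs) s            ≈⟨ +-congˡ (*-congˡ (eval-division b bs r s)) ⟩
    a + s * (fr + (s - r) * q)
      ≈⟨ solve 5 (λ a s r fr q → a :+ s :* (fr :+ (s :- r) :* q) := (a :+ r :* fr) :+ (s :- r) :* (fr :+ s :* q)) refl a s r fr q ⟩
    (a + r * fr) + (s - r) * (fr + s * q) ∎
    where
    fr q : Carrier
    fr = eval (b ∷ bs) r
    q  = eval (quotient r bs) s

  quotient-IsZero : ∀ r a as → eval (a ∷ as) r ≈ 0# → IsZero (quotient r as) → IsZero (a ∷ as)
  quotient-IsZero r a []       fr≈0 [] = trans (sym (+-identityʳ a)) (trans (+-congˡ (sym (zeroʳ r))) fr≈0) ∷ []
  quotient-IsZero r a (b ∷ bs) fr≈0 (fb≈0 ∷ q≈0) with quotient-IsZero r b bs fb≈0 q≈0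
  ... | bs′≈0 = trans (sym (+-identityʳ a)) (trans (+-congˡ (sym (trans (*-congˡ (eval-IsZero bs′≈0 r)) (zeroʳ r)))) fr≈0) ∷ bs′≈0

  vanishes-at-distinct⇒IsZero : ∀ {rs} f → Unique rs → All (λ r → eval f r ≈ 0#) rs → length f ℕ.≤ length rs → IsZero f
  vanishes-at-distinct⇒IsZero []       _ _ _ = []
  vanishes-at-distinct⇒IsZero {[]}     (a ∷ as) _ _ ()
  vanishes-at-distinct⇒IsZero {r ∷ rs} (a ∷ as) (r∉rs ∷ rs!) (fr≈0 ∷ frs≈0) (ℕ.s≤s length≤) =
    quotient-IsZero r a as fr≈0 (vanishes-at-distinct⇒IsZero (quotient r as) rs!
      (All.zipWith (λ (r≉s , fs≈0) → quotient-root r≉s fs≈0) (r∉rs , frs≈0))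
      (≡.subst (ℕ._≤ length rs) (≡.sym (length-quotient r as)) length≤))
    where
    quotient-root : ∀ {s} → r ≉ s → eval (a ∷ as) s ≈ 0# → eval (quotient r as) s ≈ 0#
    quotient-root {s} r≉s fs≈0 with zero-product (begin
      (s - r) * eval (quotient r as) s                   ≈⟨ +-identityˡ _ ⟨
      0# + (s - r) * eval (quotient r as) s              ≈⟨ +-congʳ fr≈0 ⟨
      eval (a ∷ as) r + (s - r) * eval (quotient r as) s ≈⟨ eval-division a as r s ⟨
      eval (a ∷ as) s                                    ≈⟨ fs≈0 ⟩
      0#                                                 ∎)
    ... | inj₂ q≈0   = q≈0
    ... | inj₁ s-r≈0 = ⊥-elim (r≉s (begin
      r               ≈⟨ +-identityˡ r ⟨
      0# + r          ≈⟨ +-congʳ s-r≈0 ⟨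
      (s - r) + r     ≈⟨ solve 2 (λ s r → (s :- r) :+ r := s) refl s r ⟩
      s               ∎))

  monomial : ℕ → List Carrier
  monomial zero    = 1# ∷ []
  monomial (suc n) = 0# ∷ monomial n

  eval-monomial : ∀ n x → eval (monomial n) x ≈ x ^ n
  eval-monomial zero    x = trans (+-congˡ (zeroʳ x)) (+-identityʳ 1#)
  eval-monomial (suc n) x = trans (+-identityˡ _) (*-congˡ (eval-monomial n x))

  length-monomial : ∀ n → length (monomial n) ≡ suc n
  length-monomial zero    = ≡.refl
  length-monomial (suc n) = ≡.cong suc (length-monomial n)

  monomial-≉0 : ∀ n → ¬ IsZero (monomial n)
  monomial-≉0 zero    (1≈0 ∷ _) = 1≉0 1≈0
  monomial-≉0 (suc n) (_ ∷ m≈0) = monomial-≉0 n m≈0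

  roots-of-^-bound : ∀ m b {rs} → Unique rs → All (λ r → r ^ suc m ≈ b) rs → length rs ℕ.≤ suc m
  roots-of-^-bound m b {rs} rs! roots with length rs ℕ.≤? suc m
  ... | yes length≤ = length≤
  ... | no length≰  = ⊥-elim (monomial-≉0 (suc m) (refl ∷ All.tail (vanishes-at-distinct⇒IsZero f rs! (All.map root roots) length-f≤)))
    where
    f : List Carrier
    f = - b ∷ monomial m
    root : ∀ {r} → r ^ suc m ≈ b → eval f r ≈ 0#
    root {r} r^1+m≈b = trans (+-congˡ (trans (*-congˡ (eval-monomial m r)) r^1+m≈b)) (-‿inverseˡ b)
    length-f≤ : length f ℕ.≤ length rs
    length-f≤ = ≡.subst (ℕ._≤ length rs) (≡.sym (≡.cong suc (length-monomial m))) (ℕP.≰⇒> length≰)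

module FibreCounting {c ℓ : Level} (F : FiniteField c ℓ) where
  open FiniteFieldProperties F

  fibre : (Carrier → Carrier) → Carrier → List Carrier → List Carrier
  fibre f z = filter (λ x → f x ≟ z)

  Σfibres : (Carrier → Carrier) → List Carrier → List Carrier → ℕ
  Σfibres f zs xs = sumℕ (map (λ z → length (fibre f z xs)) zs)

  Σfibres-mono : ∀ f x xs zs → Σfibres f zs xs ℕ.≤ Σfibres f zs (x ∷ xs)
  Σfibres-mono f x xs []       = ℕ.z≤n
  Σfibres-mono f x xs (z ∷ zs) with f x ≟ z
  ... | yes _ = ℕP.+-mono-≤ (ℕP.n≤1+n _) (Σfibres-mono f x xs zs)
  ... | no _  = ℕP.+-monoʳ-≤ (length (fibre f z xs)) (Σfibres-mono f x xs zs)

  Σfibres-step : ∀ f x xs {zs} → f x ∈ zs → suc (Σfibres f zs xs) ℕ.≤ Σfibres f zs (x ∷ xs)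
  Σfibres-step f x xs {z ∷ zs} fx∈z∷zs with f x ≟ z | fx∈z∷zs
  ... | yes _   | _            = ℕ.s≤s (ℕP.+-monoʳ-≤ (length (fibre f z xs)) (Σfibres-mono f x xs zs))
  ... | no fx≉z | here fx≈z    = ⊥-elim (fx≉z fx≈z)
  ... | no _    | there fx∈zs  = ℕP.≤-trans (ℕP.≤-reflexive (≡.sym (ℕP.+-suc _ _)))
                                   (ℕP.+-monoʳ-≤ (length (fibre f z xs)) (Σfibres-step f x xs fx∈zs))

  length≤Σfibres : ∀ f {xs} zs → All (λ x → f x ∈ zs) xs → length xs ℕ.≤ Σfibres f zs xs
  length≤Σfibres f zs []                          = ℕ.z≤n
  length≤Σfibres f zs (_∷_ {x} {xs} fx∈zs fxs⊆zs) = ℕP.≤-trans (ℕ.s≤s (length≤Σfibres f zs fxs⊆zs)) (Σfibres-step f x xs fx∈zs)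

  Σfibres≤ : ∀ f xs {zs k} → All (λ z → length (fibre f z xs) ℕ.≤ k) zs → Σfibres f zs xs ℕ.≤ length zs ℕ.* k
  Σfibres≤ f xs []                = ℕ.z≤n
  Σfibres≤ f xs (fibre≤k ∷ rest) = ℕP.+-mono-≤ fibre≤k (Σfibres≤ f xs rest)

module PowerMaps {c ℓ : Level} (F : FiniteField c ℓ) where
  open FiniteFieldProperties F
  open Polynomials F using (roots-of-^-bound)
  open FibreCounting F

  N>0 : 0 ℕ.< N
  N>0 = nonempty (∈-units 1≉0)
    where
    nonempty : ∀ {x xs} → x ∈ xs → 0 ℕ.< length xs
    nonempty (here _)  = ℕ.s≤s ℕ.z≤n
    nonempty (there _) = ℕ.s≤s ℕ.z≤n

  non-root-exists : ∀ M → 0 ℕ.< M → M ℕ.< N → Σ Carrier λ x → x ≉ 0# × x ^ M ≉ 1#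
  non-root-exists (suc m) _ M<N with any? (λ x → ¬? (x ^ suc m ≟ 1#)) units
  ... | yes some = Any.lookup some , All.lookupAny units-≉0 some
  ... | no none  = ⊥-elim (ℕP.<⇒≱ M<N (roots-of-^-bound m 1# units-unique
                     (All.map (λ {x} → decidable-stable (x ^ suc m ≟ 1#)) (AllP.¬Any⇒All¬ units none))))

  ^-onto-roots-of-unity : ∀ k m → k ℕ.* m ≡ N → ∀ {y} → y ^ m ≈ 1# → Σ Carrier λ x → x ^ k ≈ y
  ^-onto-roots-of-unity zero    m    km≡N _ = ⊥-elim (ℕP.<⇒≢ N>0 km≡N)
  ^-onto-roots-of-unity (suc k) zero km≡N _ = ⊥-elim (ℕP.<⇒≢ N>0 (≡.trans (≡.sym (ℕP.*-zeroʳ (suc k))) km≡N))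
  ^-onto-roots-of-unity (suc k) (suc m) km≡N {y} y^m≈1 with any? (λ x → x ^ suc k ≟ y) elements
  ... | yes hit = Any.satisfied hit
  ... | no miss = ⊥-elim (ℕP.<-irrefl ≡.refl (begin-strict
    N                          ≤⟨ length≤Σfibres (_^ suc k) others (All.map ^k∈others units-≉0) ⟩
    Σfibres (_^ suc k) others units ≤⟨ Σfibres≤ (_^ suc k) units {others} (All.tabulate (λ _ → fibre≤)) ⟩
    length others ℕ.* suc k    ≤⟨ ℕP.*-monoˡ-≤ (suc k) (ℕP.≤-pred others<) ⟩
    m ℕ.* suc k                <⟨ ℕP.*-monoˡ-< (suc k) (ℕP.n<1+n m) ⟩
    suc m ℕ.* suc k            ≡⟨ ℕP.*-comm (suc m) (suc k) ⟩
    suc k ℕ.* suc m            ≡⟨ km≡N ⟩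
    N                          ∎))
    where
    open ℕP.≤-Reasoning
    IsOther : Carrier → Set ℓ
    IsOther z = z ^ suc m ≈ 1# × z ≉ y
    IsOther? : ∀ z → Dec (IsOther z)
    IsOther? z = (z ^ suc m ≟ 1#) ×-dec ¬? (z ≟ y)
    others : List Carrier
    others = filter IsOther? elements
    others-IsOther : All IsOther others
    others-IsOther = AllP.all-filter IsOther? elements
    others< : suc (length others) ℕ.≤ suc m
    others< = roots-of-^-bound m 1#
      (All.map (λ (_ , z≉y) y≈z → z≉y (sym y≈z)) others-IsOther ∷ UniqueP.filter⁺ setoid IsOther? elements-unique)
      (y^m≈1 ∷ All.map proj₁ others-IsOther)
    IsOther-resp : ∀ {a b} → a ≈ b → IsOther a → IsOther b
    IsOther-resp a≈b (a^m≈1 , a≉y) = trans (^-congˡ (suc m) (sym a≈b)) a^m≈1 , λ b≈y → a≉y (trans a≈b b≈y)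
    ^k≉y : ∀ x → x ^ suc k ≉ y
    ^k≉y x x^k≈y = miss (Any.map (λ {z} x≈z → trans (^-congˡ (suc k) (sym x≈z)) x^k≈y) (∈-elements x))
    ^k∈others : ∀ {x} → x ≉ 0# → x ^ suc k ∈ others
    ^k∈others {x} x≉0 = MembershipP.∈-filter⁺ setoid IsOther? IsOther-resp (∈-elements (x ^ suc k))
      (trans (^-assocʳ x (suc k) (suc m)) (trans (^-congʳ x km≡N) (^N≈1 x≉0)) , ^k≉y x)
    fibre≤ : ∀ {z} → length (fibre (_^ suc k) z units) ℕ.≤ suc k
    fibre≤ {z} = roots-of-^-bound k z (UniqueP.filter⁺ setoid (λ x → x ^ suc k ≟ z) units-unique) (AllP.all-filter (λ x → x ^ suc k ≟ z) units)

module SumFProperties {c ℓ : Level} (F : FiniteField c ℓ) where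
  open FiniteField F

  sumF-cong : ∀ n {f g : Fin n → Carrier} → (∀ i → f i ≈ g i) → sumF F n f ≈ sumF F n g
  sumF-cong zero    f≈g = refl
  sumF-cong (suc n) f≈g = +-cong (f≈g fzero) (sumF-cong n (f≈g ∘ fsuc))

  sumF-hom : ∀ (h : Carrier → Carrier) → (∀ x y → h (x + y) ≈ h x + h y) → h 0# ≈ 0# →
             ∀ n (f : Fin n → Carrier) → h (sumF F n f) ≈ sumF F n (h ∘ f)
  sumF-hom h h-+ h-0 zero    f = h-0
  sumF-hom h h-+ h-0 (suc n) f = trans (h-+ _ _) (+-congˡ (sumF-hom h h-+ h-0 n (f ∘ fsuc)))

  sumF-zero : ∀ n {f : Fin n → Carrier} → (∀ i → f i ≈ 0#) → sumF F n f ≈ 0#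
  sumF-zero n f≈0 = trans (sumF-cong n f≈0) (zeros n)
    where
    zeros : ∀ n → sumF F n (λ _ → 0#) ≈ 0#
    zeros zero    = refl
    zeros (suc n) = trans (+-identityˡ _) (zeros n)

  sumF-single : ∀ n {f : Fin n → Carrier} j → (∀ i → i ≢ j → f i ≈ 0#) → sumF F n f ≈ f j
  sumF-single (suc n) fzero    f≈0 = trans (+-congˡ (sumF-zero n (λ i → f≈0 (fsuc i) λ ()))) (+-identityʳ _)
  sumF-single (suc n) (fsuc j) f≈0 = trans (+-congʳ (f≈0 fzero λ ())) (trans (+-identityˡ _)
    (sumF-single n j (λ i i≢j → f≈0 (fsuc i) (i≢j ∘ FinP.suc-injective))))

module FifthRootsOfUnity {c ℓ : Level} (F : FiniteField c ℓ) where
  open FiniteFieldProperties F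
  open import Relation.Binary.Reasoning.Setoid setoid

  Φ₅ : Carrier → Carrier
  Φ₅ v = 1# + v + v ^ 2 + v ^ 3 + v ^ 4

  Φ₅-cong : ∀ {u v} → u ≈ v → Φ₅ u ≈ Φ₅ v
  Φ₅-cong u≈v = +-cong (+-cong (+-cong (+-congˡ u≈v) (^-congˡ 2 u≈v)) (^-congˡ 3 u≈v)) (^-congˡ 4 u≈v)

  Φ₅-1 : Φ₅ 1# ≈ 5 · 1#
  Φ₅-1 = solve 0 (con (+ 1) :+ con (+ 1) :+ con (+ 1) :^ 2 :+ con (+ 1) :^ 3 :+ con (+ 1) :^ 4
                   := con (+ 1) :+ (con (+ 1) :+ (con (+ 1) :+ (con (+ 1) :+ (con (+ 1) :+ con (+ 0)))))) refl

  Φ₅-root : ∀ {v} → v ^ 5 ≈ 1# → v ≉ 1# → Φ₅ v ≈ 0#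
  Φ₅-root {v} v^5≈1 v≉1 with zero-product (begin
    (v - 1#) * Φ₅ v  ≈⟨ solve 1 (λ v → (v :- con (+ 1)) :* (con (+ 1) :+ v :+ v :^ 2 :+ v :^ 3 :+ v :^ 4) := v :^ 5 :- con (+ 1)) refl v ⟩
    v ^ 5 - 1#       ≈⟨ +-congʳ v^5≈1 ⟩
    1# - 1#          ≈⟨ -‿inverseʳ 1# ⟩
    0#               ∎)
  ... | inj₂ Φ₅v≈0 = Φ₅v≈0
  ... | inj₁ v-1≈0 = ⊥-elim (v≉1 (begin
    v              ≈⟨ solve 1 (λ v → v := (v :- con (+ 1)) :+ con (+ 1)) refl v ⟩
    (v - 1#) + 1#  ≈⟨ +-congʳ v-1≈0 ⟩
    0# + 1#        ≈⟨ +-identityˡ 1# ⟩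
    1#             ∎))

  Φ₅-≉0⇒≈1 : ∀ {v} → v ^ 5 ≈ 1# → Φ₅ v ≉ 0# → v ≈ 1#
  Φ₅-≉0⇒≈1 {v} v^5≈1 Φ₅v≉0 with v ≟ 1#
  ... | yes v≈1 = v≈1
  ... | no v≉1  = ⊥-elim (Φ₅v≉0 (Φ₅-root v^5≈1 v≉1))

  ^5≈1-* : ∀ {a b} → a ^ 5 ≈ 1# → b ^ 5 ≈ 1# → (a * b) ^ 5 ≈ 1#
  ^5≈1-* {a} {b} a^5≈1 b^5≈1 = trans (^-distrib-* a b 5) (trans (*-cong a^5≈1 b^5≈1) (*-identityˡ 1#))

  ^5≈1-^ : ∀ {a} n → a ^ 5 ≈ 1# → (a ^ n) ^ 5 ≈ 1#
  ^5≈1-^ {a} n a^5≈1 = trans (^-swap a n 5) (trans (^-congˡ n a^5≈1) (1^ n))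

  ^5≈1-inverse : ∀ {a u} → a ^ 5 ≈ 1# → a ^ 4 * u ≈ 1# → u ≈ a
  ^5≈1-inverse {a} {u} a^5≈1 a^4u≈1 = begin
    u               ≈⟨ *-identityˡ u ⟨
    1# * u          ≈⟨ *-congʳ a^5≈1 ⟨
    a ^ 5 * u       ≈⟨ solve 2 (λ a u → a :^ 5 :* u := a :* (a :^ 4 :* u)) refl a u ⟩
    a * (a ^ 4 * u) ≈⟨ *-congˡ a^4u≈1 ⟩
    a * 1#          ≈⟨ *-identityʳ a ⟩
    a               ∎

  module Primitive {ζ : Carrier} (ζ^5≈1 : ζ ^ 5 ≈ 1#) (ζ≉1 : ζ ≉ 1#) where

    ζ≉0 : ζ ≉ 0#
    ζ≉0 ζ≈0 = 1≉0 (trans (sym ζ^5≈1) (trans (^-congˡ 5 ζ≈0) (0^≈0 {5} ℕ.z<s)))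

    ζ^≉1 : ∀ d → 0 ℕ.< d → d ℕ.< 5 → ζ ^ d ≉ 1#
    ζ^≉1 d 0<d d<5 ζ^d≈1 with inverse-mod-5 d 0<d d<5
      where
      inverse-mod-5 : ∀ d → 0 ℕ.< d → d ℕ.< 5 → ∃₂ λ a b → d ℕ.* b ≡ 5 ℕ.* a ℕ.+ 1
      inverse-mod-5 1 _ _ = 0 , 1 , ≡.refl
      inverse-mod-5 2 _ _ = 1 , 3 , ≡.refl
      inverse-mod-5 3 _ _ = 1 , 2 , ≡.refl
      inverse-mod-5 4 _ _ = 3 , 4 , ≡.refl
      inverse-mod-5 (suc (suc (suc (suc (suc _))))) _ (ℕ.s≤s (ℕ.s≤s (ℕ.s≤s (ℕ.s≤s (ℕ.s≤s ())))))
    ... | a , b , db≡5a+1 = ζ≉1 (begin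
      ζ                     ≈⟨ *-identityʳ ζ ⟨
      ζ * 1#                ≈⟨ *-congˡ (trans (^-congˡ a ζ^5≈1) (1^ a)) ⟨
      ζ * (ζ ^ 5) ^ a       ≈⟨ *-congˡ (^-assocʳ ζ 5 a) ⟩
      ζ ^ suc (5 ℕ.* a)     ≡⟨ ≡.cong (ζ ^_) (≡.trans (ℕP.+-comm 1 (5 ℕ.* a)) (≡.sym db≡5a+1)) ⟩
      ζ ^ (d ℕ.* b)         ≈⟨ ^-assocʳ ζ d b ⟨
      (ζ ^ d) ^ b           ≈⟨ ^-congˡ b ζ^d≈1 ⟩
      1# ^ b                ≈⟨ 1^ b ⟩
      1#                    ∎)

    ζ^-gap : ∀ {a b} → a ℕ.< b → b ℕ.< 5 → ζ ^ a ≉ ζ ^ b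
    ζ^-gap {a} {b} a<b b<5 ζ^a≈ζ^b = ζ^≉1 (b ℕ.∸ a) (ℕP.m<n⇒0<n∸m a<b) (ℕP.≤-<-trans (ℕP.m∸n≤m b a) b<5)
      (*-cancelˡ (^-≉0 a ζ≉0) (begin
        ζ ^ a * ζ ^ (b ℕ.∸ a)  ≈⟨ ^-homo-* ζ a (b ℕ.∸ a) ⟨
        ζ ^ (a ℕ.+ (b ℕ.∸ a))  ≡⟨ ≡.cong (ζ ^_) (ℕP.m+[n∸m]≡n (ℕP.<⇒≤ a<b)) ⟩
        ζ ^ b                  ≈⟨ ζ^a≈ζ^b ⟨
        ζ ^ a                  ≈⟨ *-identityʳ _ ⟨
        ζ ^ a * 1#             ∎))

    ζ^-injective : ∀ {a b} → a ℕ.< 5 → b ℕ.< 5 → ζ ^ a ≈ ζ ^ b → a ≡ b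
    ζ^-injective {a} {b} a<5 b<5 ζ^a≈ζ^b with ℕP.<-cmp a b
    ... | B.tri≈ _ a≡b _ = a≡b
    ... | B.tri< a<b _ _ = ⊥-elim (ζ^-gap a<b b<5 ζ^a≈ζ^b)
    ... | B.tri> _ _ b<a = ⊥-elim (ζ^-gap b<a a<5 (sym ζ^a≈ζ^b))

module Resolvents {c ℓ : Level} (F : FiniteField c ℓ) where
  open FiniteFieldProperties F
  open FifthRootsOfUnity F
  open SumFProperties F
  open import Relation.Binary.Reasoning.Setoid setoid

  record OrderFiveAutomorphism : Set (c Level.⊔ ℓ) where
    field
      σ                   : Carrier → Carrier
      σ-cong              : ∀ {x y} → x ≈ y → σ x ≈ σ y
      σ-+                 : ∀ x y → σ (x + y) ≈ σ x + σ y
      σ-*                 : ∀ x y → σ (x * y) ≈ σ x * σ y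
      σ⁵≈id               : ∀ x → σ (σ (σ (σ (σ x)))) ≈ x
      σ-fixes-fifth-roots : ∀ {u} → u ^ 5 ≈ 1# → σ u ≈ u

  combination : Carrier → Carrier → Carrier → Carrier → Carrier → Carrier → Carrier
  combination η y₀ y₁ y₂ y₃ y₄ = y₀ + η * y₁ + η ^ 2 * y₂ + η ^ 3 * y₃ + η ^ 4 * y₄

  combination-cong : ∀ η {y₀ y₁ y₂ y₃ y₄ z₀ z₁ z₂ z₃ z₄} →
                     y₀ ≈ z₀ → y₁ ≈ z₁ → y₂ ≈ z₂ → y₃ ≈ z₃ → y₄ ≈ z₄ →
                     combination η y₀ y₁ y₂ y₃ y₄ ≈ combination η z₀ z₁ z₂ z₃ z₄
  combination-cong η e₀ e₁ e₂ e₃ e₄ = +-cong (+-cong (+-cong (+-cong e₀ (*-congˡ e₁)) (*-congˡ e₂)) (*-congˡ e₃)) (*-congˡ e₄)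

  combination-rotate : ∀ {ξ} → ξ ^ 5 ≈ 1# → ∀ y₀ y₁ y₂ y₃ y₄ →
                       combination (ξ ^ 4) y₁ y₂ y₃ y₄ y₀ ≈ ξ * combination (ξ ^ 4) y₀ y₁ y₂ y₃ y₄
  combination-rotate {ξ} ξ^5≈1 y₀ y₁ y₂ y₃ y₄ = begin
    combination (ξ ^ 4) y₁ y₂ y₃ y₄ y₀
      ≈⟨ solve 6 (λ ξ y₀ y₁ y₂ y₃ y₄ → y₁ :+ ξ :^ 4 :* y₂ :+ (ξ :^ 4) :^ 2 :* y₃ :+ (ξ :^ 4) :^ 3 :* y₄ :+ (ξ :^ 4) :^ 4 :* y₀
           := (y₁ :+ ξ :^ 4 :* y₂ :+ (ξ :^ 4) :^ 2 :* y₃ :+ (ξ :^ 4) :^ 3 :* y₄) :+ (ξ :^ 5) :^ 3 :* (ξ :* y₀)) refl ξ y₀ y₁ y₂ y₃ y₄ ⟩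
    rest + (ξ ^ 5) ^ 3 * (ξ * y₀)   ≈⟨ +-congˡ (*-congʳ (trans (^-congˡ 3 ξ^5≈1) (1^ 3))) ⟩
    rest + 1# * (ξ * y₀)            ≈⟨ trans (+-comm _ _) (+-cong (*-identityˡ _) (sym (*-identityˡ _))) ⟩
    ξ * y₀ + 1# * rest              ≈⟨ +-congˡ (*-congʳ ξ^5≈1) ⟨
    ξ * y₀ + ξ ^ 5 * rest
      ≈⟨ solve 6 (λ ξ y₀ y₁ y₂ y₃ y₄ → ξ :* y₀ :+ ξ :^ 5 :* (y₁ :+ ξ :^ 4 :* y₂ :+ (ξ :^ 4) :^ 2 :* y₃ :+ (ξ :^ 4) :^ 3 :* y₄)
           := ξ :* (y₀ :+ ξ :^ 4 :* y₁ :+ (ξ :^ 4) :^ 2 :* y₂ :+ (ξ :^ 4) :^ 3 :* y₃ :+ (ξ :^ 4) :^ 4 :* y₄)) refl ξ y₀ y₁ y₂ y₃ y₄ ⟩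
    ξ * combination (ξ ^ 4) y₀ y₁ y₂ y₃ y₄ ∎
    where
    rest : Carrier
    rest = y₁ + ξ ^ 4 * y₂ + (ξ ^ 4) ^ 2 * y₃ + (ξ ^ 4) ^ 3 * y₄

  module Decomposition (A : OrderFiveAutomorphism) where
    open OrderFiveAutomorphism A

    σ-0 : σ 0# ≈ 0#
    σ-0 = begin
      σ 0#                    ≈⟨ solve 1 (λ s → s := (s :+ s) :- s) refl (σ 0#) ⟩
      (σ 0# + σ 0#) - σ 0#    ≈⟨ +-congʳ (σ-+ 0# 0#) ⟨
      σ (0# + 0#) - σ 0#      ≈⟨ +-congʳ (σ-cong (+-identityʳ 0#)) ⟩
      σ 0# - σ 0#             ≈⟨ -‿inverseʳ _ ⟩
      0#                      ∎

    σ-1 : σ 1# ≈ 1#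
    σ-1 = σ-fixes-fifth-roots (1^ 5)

    σ-·1 : ∀ n → σ (n · 1#) ≈ n · 1#
    σ-·1 zero    = σ-0
    σ-·1 (suc n) = trans (σ-+ _ _) (+-cong σ-1 (σ-·1 n))

    σ-^ : ∀ x n → σ (x ^ n) ≈ σ x ^ n
    σ-^ x zero    = σ-1
    σ-^ x (suc n) = trans (σ-* _ _) (*-congˡ (σ-^ x n))

    σ^ : ℕ → Carrier → Carrier
    σ^ zero    y = y
    σ^ (suc n) y = σ (σ^ n y)

    σ^-cong : ∀ n {x y} → x ≈ y → σ^ n x ≈ σ^ n y
    σ^-cong zero    x≈y = x≈y
    σ^-cong (suc n) x≈y = σ-cong (σ^-cong n x≈y)

    σ^-+ : ∀ n x y → σ^ n (x + y) ≈ σ^ n x + σ^ n y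
    σ^-+ zero    x y = refl
    σ^-+ (suc n) x y = trans (σ-cong (σ^-+ n x y)) (σ-+ _ _)

    σ^-0 : ∀ n → σ^ n 0# ≈ 0#
    σ^-0 zero    = refl
    σ^-0 (suc n) = trans (σ-cong (σ^-0 n)) σ-0

    σ^-eigenvector : ∀ {z u} → σ z ≈ u * z → u ^ 5 ≈ 1# → ∀ n → σ^ n z ≈ u ^ n * z
    σ^-eigenvector {z} {u} σz≈uz u^5≈1 zero    = sym (*-identityˡ z)
    σ^-eigenvector {z} {u} σz≈uz u^5≈1 (suc n) = begin
      σ (σ^ n z)        ≈⟨ σ-cong (σ^-eigenvector σz≈uz u^5≈1 n) ⟩
      σ (u ^ n * z)     ≈⟨ σ-* _ _ ⟩
      σ (u ^ n) * σ z   ≈⟨ *-cong (trans (σ-^ u n) (^-congˡ n (σ-fixes-fifth-roots u^5≈1))) σz≈uz ⟩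
      u ^ n * (u * z)   ≈⟨ solve 3 (λ a u z → a :* (u :* z) := (u :* a) :* z) refl (u ^ n) u z ⟩
      u ^ suc n * z     ∎

    -- For a fifth root of unity ξ, ξ ^ 4 is ξ⁻¹, so this is Σᵢ ξ⁻ⁱ σⁱ y.
    resolvent : Carrier → Carrier → Carrier
    resolvent ξ y = combination (ξ ^ 4) y (σ^ 1 y) (σ^ 2 y) (σ^ 3 y) (σ^ 4 y)

    resolvent-cong : ∀ ξ {x y} → x ≈ y → resolvent ξ x ≈ resolvent ξ y
    resolvent-cong ξ x≈y = combination-cong (ξ ^ 4) x≈y (σ^-cong 1 x≈y) (σ^-cong 2 x≈y) (σ^-cong 3 x≈y) (σ^-cong 4 x≈y)

    resolvent-+ : ∀ ξ x y → resolvent ξ (x + y) ≈ resolvent ξ x + resolvent ξ y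
    resolvent-+ ξ x y = trans (combination-cong (ξ ^ 4) refl (σ^-+ 1 x y) (σ^-+ 2 x y) (σ^-+ 3 x y) (σ^-+ 4 x y))
      (solve 11 (λ η x y x₁ y₁ x₂ y₂ x₃ y₃ x₄ y₄ →
          (x :+ y) :+ η :* (x₁ :+ y₁) :+ η :^ 2 :* (x₂ :+ y₂) :+ η :^ 3 :* (x₃ :+ y₃) :+ η :^ 4 :* (x₄ :+ y₄)
        := (x :+ η :* x₁ :+ η :^ 2 :* x₂ :+ η :^ 3 :* x₃ :+ η :^ 4 :* x₄)
           :+ (y :+ η :* y₁ :+ η :^ 2 :* y₂ :+ η :^ 3 :* y₃ :+ η :^ 4 :* y₄)) refl
        (ξ ^ 4) x y (σ^ 1 x) (σ^ 1 y) (σ^ 2 x) (σ^ 2 y) (σ^ 3 x) (σ^ 3 y) (σ^ 4 x) (σ^ 4 y))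

    resolvent-0 : ∀ ξ → resolvent ξ 0# ≈ 0#
    resolvent-0 ξ = trans (combination-cong (ξ ^ 4) refl (σ^-0 1) (σ^-0 2) (σ^-0 3) (σ^-0 4))
      (solve 1 (λ η → con (+ 0) :+ η :* con (+ 0) :+ η :^ 2 :* con (+ 0) :+ η :^ 3 :* con (+ 0) :+ η :^ 4 :* con (+ 0) := con (+ 0)) refl (ξ ^ 4))

    resolvent-sumF : ∀ ξ n (f : Fin n → Carrier) → resolvent ξ (sumF F n f) ≈ sumF F n (resolvent ξ ∘ f)
    resolvent-sumF ξ = sumF-hom (resolvent ξ) (resolvent-+ ξ) (resolvent-0 ξ)

    σ-combination : ∀ {η} → σ η ≈ η → ∀ y₀ y₁ y₂ y₃ y₄ →
                    σ (combination η y₀ y₁ y₂ y₃ y₄) ≈ combination η (σ y₀) (σ y₁) (σ y₂) (σ y₃) (σ y₄)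
    σ-combination {η} ση≈η y₀ y₁ y₂ y₃ y₄ =
      trans (σ-+ _ _) (+-cong (trans (σ-+ _ _) (+-cong (trans (σ-+ _ _) (+-cong (trans (σ-+ _ _) (+-cong refl
        (σ-scale ση≈η))) (σ-scale (ση^≈η^ 2)))) (σ-scale (ση^≈η^ 3)))) (σ-scale (ση^≈η^ 4)))
      where
      ση^≈η^ : ∀ i → σ (η ^ i) ≈ η ^ i
      ση^≈η^ i = trans (σ-^ η i) (^-congˡ i ση≈η)
      σ-scale : ∀ {a y} → σ a ≈ a → σ (a * y) ≈ a * σ y
      σ-scale σa≈a = trans (σ-* _ _) (*-congʳ σa≈a)

    σ-resolvent : ∀ {ξ} → ξ ^ 5 ≈ 1# → ∀ y → σ (resolvent ξ y) ≈ ξ * resolvent ξ y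
    σ-resolvent {ξ} ξ^5≈1 y = begin
      σ (resolvent ξ y)                                                   ≈⟨ σ-combination (σ-fixes-fifth-roots (^5≈1-^ 4 ξ^5≈1)) _ _ _ _ _ ⟩
      combination (ξ ^ 4) (σ^ 1 y) (σ^ 2 y) (σ^ 3 y) (σ^ 4 y) (σ^ 5 y)    ≈⟨ combination-cong (ξ ^ 4) refl refl refl refl (σ⁵≈id y) ⟩
      combination (ξ ^ 4) (σ^ 1 y) (σ^ 2 y) (σ^ 3 y) (σ^ 4 y) y          ≈⟨ combination-rotate ξ^5≈1 y _ _ _ _ ⟩
      ξ * resolvent ξ y                                                   ∎

    resolvent-eigenvector : ∀ {z u} → σ z ≈ u * z → u ^ 5 ≈ 1# → ∀ ξ → resolvent ξ z ≈ z * Φ₅ (ξ ^ 4 * u)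
    resolvent-eigenvector {z} {u} σz≈uz u^5≈1 ξ = trans
      (combination-cong (ξ ^ 4) refl (σ^ᵤ 1) (σ^ᵤ 2) (σ^ᵤ 3) (σ^ᵤ 4))
      (solve 3 (λ η z u → z :+ η :* (u :^ 1 :* z) :+ η :^ 2 :* (u :^ 2 :* z) :+ η :^ 3 :* (u :^ 3 :* z) :+ η :^ 4 :* (u :^ 4 :* z)
                := z :* (con (+ 1) :+ η :* u :+ (η :* u) :^ 2 :+ (η :* u) :^ 3 :+ (η :* u) :^ 4)) refl (ξ ^ 4) z u)
      where
      σ^ᵤ : ∀ n → σ^ n z ≈ u ^ n * z
      σ^ᵤ = σ^-eigenvector σz≈uz u^5≈1

    module Spectral {ζ : Carrier} (ζ^5≈1 : ζ ^ 5 ≈ 1#) (ζ≉1 : ζ ≉ 1#) (5≉0 : 5 · 1# ≉ 0#) where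
      open Primitive ζ^5≈1 ζ≉1

      ζ^[5q+r]≉1 : ∀ q r → 0 ℕ.< r → r ℕ.< 5 → ζ ^ (5 ℕ.* q ℕ.+ r) ≉ 1#
      ζ^[5q+r]≉1 q r 0<r r<5 ζ^[5q+r]≈1 = ζ^≉1 r 0<r r<5 (begin
        ζ ^ r                       ≈⟨ *-identityˡ _ ⟨
        1# * ζ ^ r                  ≈⟨ *-congʳ (trans (^-congˡ q ζ^5≈1) (1^ q)) ⟨
        (ζ ^ 5) ^ q * ζ ^ r         ≈⟨ *-congʳ (^-assocʳ ζ 5 q) ⟩
        ζ ^ (5 ℕ.* q) * ζ ^ r       ≈⟨ ^-homo-* ζ (5 ℕ.* q) r ⟨
        ζ ^ (5 ℕ.* q ℕ.+ r)         ≈⟨ ζ^[5q+r]≈1 ⟩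
        1#                          ∎)

      Φ₅-ζ^ : ∀ q r → 0 ℕ.< r → r ℕ.< 5 → Φ₅ (ζ ^ (5 ℕ.* q ℕ.+ r)) ≈ 0#
      Φ₅-ζ^ q r 0<r r<5 = Φ₅-root (^5≈1-^ (5 ℕ.* q ℕ.+ r) ζ^5≈1) (ζ^[5q+r]≉1 q r 0<r r<5)

      sumF-resolvent : ∀ y → sumF F 5 (λ j → resolvent (ζ ^ toℕ j) y) ≈ 5 · 1# * y
      sumF-resolvent y = begin
        sumF F 5 (λ j → resolvent (ζ ^ toℕ j) y)
          ≈⟨ solve 6 (λ z y y₁ y₂ y₃ y₄ →
                 (y :+ (z :^ 0) :^ 4 :* y₁ :+ ((z :^ 0) :^ 4) :^ 2 :* y₂ :+ ((z :^ 0) :^ 4) :^ 3 :* y₃ :+ ((z :^ 0) :^ 4) :^ 4 :* y₄)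
              :+ ((y :+ (z :^ 1) :^ 4 :* y₁ :+ ((z :^ 1) :^ 4) :^ 2 :* y₂ :+ ((z :^ 1) :^ 4) :^ 3 :* y₃ :+ ((z :^ 1) :^ 4) :^ 4 :* y₄)
              :+ ((y :+ (z :^ 2) :^ 4 :* y₁ :+ ((z :^ 2) :^ 4) :^ 2 :* y₂ :+ ((z :^ 2) :^ 4) :^ 3 :* y₃ :+ ((z :^ 2) :^ 4) :^ 4 :* y₄)
              :+ ((y :+ (z :^ 3) :^ 4 :* y₁ :+ ((z :^ 3) :^ 4) :^ 2 :* y₂ :+ ((z :^ 3) :^ 4) :^ 3 :* y₃ :+ ((z :^ 3) :^ 4) :^ 4 :* y₄)
              :+ ((y :+ (z :^ 4) :^ 4 :* y₁ :+ ((z :^ 4) :^ 4) :^ 2 :* y₂ :+ ((z :^ 4) :^ 4) :^ 3 :* y₃ :+ ((z :^ 4) :^ 4) :^ 4 :* y₄)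
              :+ con (+ 0)))))
              := (con (+ 1) :+ (con (+ 1) :+ (con (+ 1) :+ (con (+ 1) :+ (con (+ 1) :+ con (+ 0)))))) :* y
              :+ (con (+ 1) :+ z :^ 4 :+ (z :^ 4) :^ 2 :+ (z :^ 4) :^ 3 :+ (z :^ 4) :^ 4) :* y₁
              :+ (con (+ 1) :+ z :^ 8 :+ (z :^ 8) :^ 2 :+ (z :^ 8) :^ 3 :+ (z :^ 8) :^ 4) :* y₂
              :+ (con (+ 1) :+ z :^ 12 :+ (z :^ 12) :^ 2 :+ (z :^ 12) :^ 3 :+ (z :^ 12) :^ 4) :* y₃
              :+ (con (+ 1) :+ z :^ 16 :+ (z :^ 16) :^ 2 :+ (z :^ 16) :^ 3 :+ (z :^ 16) :^ 4) :* y₄)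
              refl ζ y (σ^ 1 y) (σ^ 2 y) (σ^ 3 y) (σ^ 4 y) ⟩
        5 · 1# * y + Φ₅ (ζ ^ 4) * σ^ 1 y + Φ₅ (ζ ^ 8) * σ^ 2 y + Φ₅ (ζ ^ 12) * σ^ 3 y + Φ₅ (ζ ^ 16) * σ^ 4 y
          ≈⟨ +-cong (+-cong (+-cong (+-congˡ (vanish 0 4)) (vanish 1 3)) (vanish 2 2)) (vanish 3 1) ⟩
        5 · 1# * y + 0# + 0# + 0# + 0#
          ≈⟨ trans (+-identityʳ _) (trans (+-identityʳ _) (trans (+-identityʳ _) (+-identityʳ _))) ⟩
        5 · 1# * y ∎
        where
        vanish : ∀ q r → {T (0 ℕ.<ᵇ r)} → {T (r ℕ.<ᵇ 5)} → ∀ {s} → Φ₅ (ζ ^ (5 ℕ.* q ℕ.+ r)) * s ≈ 0#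
        vanish q r {0<r} {r<5} = trans (*-congʳ (Φ₅-ζ^ q r (ℕP.<ᵇ⇒< 0 r 0<r) (ℕP.<ᵇ⇒< r 5 r<5))) (zeroˡ _)

      5⁻¹ : Carrier
      5⁻¹ = proj₁ (inverse (5 · 1#) 5≉0)

      5*5⁻¹≈1 : 5 · 1# * 5⁻¹ ≈ 1#
      5*5⁻¹≈1 = proj₂ (inverse (5 · 1#) 5≉0)

      σ-5⁻¹ : σ 5⁻¹ ≈ 5⁻¹
      σ-5⁻¹ = *-cancelˡ 5≉0 (begin
        5 · 1# * σ 5⁻¹        ≈⟨ *-congʳ (σ-·1 5) ⟨
        σ (5 · 1#) * σ 5⁻¹    ≈⟨ σ-* _ _ ⟨
        σ (5 · 1# * 5⁻¹)      ≈⟨ σ-cong 5*5⁻¹≈1 ⟩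
        σ 1#                  ≈⟨ σ-1 ⟩
        1#                    ≈⟨ 5*5⁻¹≈1 ⟨
        5 · 1# * 5⁻¹          ∎)

      component : ℕ → Carrier → Carrier
      component j y = 5⁻¹ * resolvent (ζ ^ j) y

      σ-component : ∀ j y → σ (component j y) ≈ ζ ^ j * component j y
      σ-component j y = begin
        σ (5⁻¹ * resolvent (ζ ^ j) y)           ≈⟨ σ-* _ _ ⟩
        σ 5⁻¹ * σ (resolvent (ζ ^ j) y)         ≈⟨ *-cong σ-5⁻¹ (σ-resolvent (^5≈1-^ j ζ^5≈1) y) ⟩
        5⁻¹ * (ζ ^ j * resolvent (ζ ^ j) y)     ≈⟨ solve 3 (λ i a r → i :* (a :* r) := a :* (i :* r)) refl 5⁻¹ (ζ ^ j) _ ⟩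
        ζ ^ j * (5⁻¹ * resolvent (ζ ^ j) y)     ∎

      sumF-component : ∀ y → sumF F 5 (λ j → component (toℕ j) y) ≈ y
      sumF-component y = begin
        sumF F 5 (λ j → 5⁻¹ * resolvent (ζ ^ toℕ j) y)
          ≈⟨ sumF-hom (5⁻¹ *_) (distribˡ 5⁻¹) (zeroʳ 5⁻¹) 5 (λ j → resolvent (ζ ^ toℕ j) y) ⟨
        5⁻¹ * sumF F 5 (λ j → resolvent (ζ ^ toℕ j) y)   ≈⟨ *-congˡ (sumF-resolvent y) ⟩
        5⁻¹ * (5 · 1# * y)                               ≈⟨ solve 3 (λ i f y → i :* (f :* y) := (f :* i) :* y) refl 5⁻¹ (5 · 1#) y ⟩
        (5 · 1# * 5⁻¹) * y                               ≈⟨ *-congʳ 5*5⁻¹≈1 ⟩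
        1# * y                                           ≈⟨ *-identityˡ y ⟩
        y                                                ∎

      resolvent≉0⇒eigenvalue≈ : ∀ {z u} → σ z ≈ u * z → u ^ 5 ≈ 1# → ∀ a → resolvent (ζ ^ a) z ≉ 0# → u ≈ ζ ^ a
      resolvent≉0⇒eigenvalue≈ {z} {u} σz≈uz u^5≈1 a resolvent≉0 =
        ^5≈1-inverse (^5≈1-^ a ζ^5≈1) (Φ₅-≉0⇒≈1 (^5≈1-* (^5≈1-^ 4 (^5≈1-^ a ζ^5≈1)) u^5≈1) Φ₅≉0)
        where
        Φ₅≉0 : Φ₅ ((ζ ^ a) ^ 4 * u) ≉ 0#
        Φ₅≉0 Φ₅≈0 = resolvent≉0 (trans (resolvent-eigenvector σz≈uz u^5≈1 (ζ ^ a)) (trans (*-congˡ Φ₅≈0) (zeroʳ z)))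

      resolvent-off-eigenvalue : ∀ {z a b} → σ z ≈ ζ ^ b * z → a ℕ.< 5 → b ℕ.< 5 → a ≢ b → resolvent (ζ ^ a) z ≈ 0#
      resolvent-off-eigenvalue {z} {a} {b} σz≈ζ^bz a<5 b<5 a≢b with resolvent (ζ ^ a) z ≟ 0#
      ... | yes resolvent≈0 = resolvent≈0
      ... | no resolvent≉0  = ⊥-elim (a≢b (≡.sym (ζ^-injective b<5 a<5
                                (resolvent≉0⇒eigenvalue≈ σz≈ζ^bz (^5≈1-^ b ζ^5≈1) a resolvent≉0))))

      resolvent-at-eigenvalue : ∀ {z a} → σ z ≈ ζ ^ a * z → resolvent (ζ ^ a) z ≈ z * 5 · 1#
      resolvent-at-eigenvalue {z} {a} σz≈ζ^az = begin
        resolvent (ζ ^ a) z               ≈⟨ resolvent-eigenvector σz≈ζ^az (^5≈1-^ a ζ^5≈1) (ζ ^ a) ⟩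
        z * Φ₅ ((ζ ^ a) ^ 4 * ζ ^ a)
          ≈⟨ *-congˡ (Φ₅-cong (trans (solve 1 (λ x → x :^ 4 :* x := x :^ 5) refl (ζ ^ a)) (^5≈1-^ a ζ^5≈1))) ⟩
        z * Φ₅ 1#                         ≈⟨ *-congˡ Φ₅-1 ⟩
        z * 5 · 1#                        ∎

      eigenbasis-resolvent-≉0 : (zs : Fin 5 → Carrier) → (∀ i → zs i ≉ 0#) → (∀ i → σ (zs i) ≈ ζ ^ toℕ i * zs i) →
                                ∀ j → resolvent (ζ ^ toℕ j) (sumF F 5 zs) ≉ 0#
      eigenbasis-resolvent-≉0 zs zs≉0 σzs j resolvent≈0 = *-≉0 (zs≉0 j) 5≉0 (begin
        zs j * 5 · 1#                             ≈⟨ resolvent-at-eigenvalue {a = toℕ j} (σzs j) ⟨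
        resolvent (ζ ^ toℕ j) (zs j)              ≈⟨ sumF-single 5 j off ⟨
        sumF F 5 (resolvent (ζ ^ toℕ j) ∘ zs)     ≈⟨ resolvent-sumF _ 5 zs ⟨
        resolvent (ζ ^ toℕ j) (sumF F 5 zs)       ≈⟨ resolvent≈0 ⟩
        0#                                        ∎)
        where
        off : ∀ i → i ≢ j → resolvent (ζ ^ toℕ j) (zs i) ≈ 0#
        off i i≢j = resolvent-off-eigenvalue {a = toℕ j} {b = toℕ i} (σzs i) (FinP.toℕ<n j) (FinP.toℕ<n i)
                                             (i≢j ∘ ≡.sym ∘ FinP.toℕ-injective)

      short-sum-resolvent-≈0 : ∀ {n} → n ℕ.< 5 → (zs : Fin n → Carrier) →
                               (∀ i → Σ Carrier λ u → u ^ 5 ≈ 1# × σ (zs i) ≈ u * zs i) →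
                               Σ (Fin 5) λ j → resolvent (ζ ^ toℕ j) (sumF F n zs) ≈ 0#
      short-sum-resolvent-≈0 {n} n<5 zs eigen = j , trans (resolvent-sumF _ n zs) (sumF-zero n vanishes)
        where
        one-eigenvalue : ∀ i j j′ → resolvent (ζ ^ toℕ j) (zs i) ≉ 0# → resolvent (ζ ^ toℕ j′) (zs i) ≉ 0# → j ≡ j′
        one-eigenvalue i j j′ ≉0 ≉0′ = FinP.toℕ-injective (ζ^-injective (FinP.toℕ<n j) (FinP.toℕ<n j′)
          (trans (sym (eigenvalue (toℕ j) ≉0)) (eigenvalue (toℕ j′) ≉0′)))
          where
          eigenvalue : ∀ a → resolvent (ζ ^ a) (zs i) ≉ 0# → proj₁ (eigen i) ≈ ζ ^ a
          eigenvalue = resolvent≉0⇒eigenvalue≈ (proj₂ (proj₂ (eigen i))) (proj₁ (proj₂ (eigen i)))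
        column : Σ (Fin 5) λ j → ∀ i → resolvent (ζ ^ toℕ j) (zs i) ≈ 0#
        column = pigeonhole-column n<5 (λ i j → resolvent (ζ ^ toℕ j) (zs i) ≈ 0#)
                                       (λ i j → resolvent (ζ ^ toℕ j) (zs i) ≟ 0#) one-eigenvalue
        j : Fin 5
        j = proj₁ column
        vanishes : ∀ i → resolvent (ζ ^ toℕ j) (zs i) ≈ 0#
        vanishes = proj₂ column

module FrobeniusWaring {c ℓ : Level} (F : FiniteField c ℓ) {p e t k : ℕ} (p-prime : Prime p) (e>0 : 0 ℕ.< e)
                       (p^e≡1+5t : p ℕ.^ e ≡ suc (5 ℕ.* t)) (5k≡Φ₅ℕ : 5 ℕ.* k ≡ Φ₅ℕ (p ℕ.^ e))
                       (size≡[p^e]^5 : FiniteField.size F ≡ (p ℕ.^ e) ℕ.^ 5) where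
  open FiniteFieldProperties F
  open PrimeCharacteristic commRing using (^pʲ-distrib-+)
  open PowerMaps F
  open FifthRootsOfUnity F
  open Resolvents F
  open SumFProperties F
  open import Relation.Binary.Reasoning.Setoid setoid

  Q : ℕ
  Q = suc (5 ℕ.* t)

  M : ℕ
  M = k ℕ.* (5 ℕ.* t)

  N≡M*5 : N ≡ M ℕ.* 5
  N≡M*5 = ℕP.suc-injective (≡.trans (≡.sym size≡1+N) (≡.trans size≡[p^e]^5 (^5≡1+k*5t*5 {t = t} {k} p^e≡1+5t 5k≡Φ₅ℕ)))

  M>0 : 0 ℕ.< M
  M>0 = ℕP.n≢0⇒n>0 (λ M≡0 → ℕP.<⇒≢ N>0 (≡.sym (≡.trans N≡M*5 (≡.cong (ℕ._* 5) M≡0))))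

  k>0 : 0 ℕ.< k
  k>0 = ℕP.n≢0⇒n>0 (λ k≡0 → ℕP.<⇒≢ M>0 (≡.sym (≡.cong (ℕ._* (5 ℕ.* t)) k≡0)))

  p·1≈0 : p · 1# ≈ 0#
  p·1≈0 = size≡p^m⇒p·1≈0 {p} {e ℕ.* 5} (≡.trans size≡[p^e]^5 (ℕP.^-*-assoc p e 5))

  5≉0 : 5 · 1# ≉ 0#
  5≉0 5≈0 = 1≉0 (begin
    1#                          ≈⟨ +-identityʳ 1# ⟨
    1# + 0#                     ≈⟨ +-congˡ (trans (*-congʳ 5≈0) (zeroˡ _)) ⟨
    1# + 5 · 1# * t · 1#        ≈⟨ +-congˡ (×1-homo-* 5 t) ⟨
    Q · 1#                      ≡⟨ ≡.cong (_· 1#) p^e≡1+5t ⟨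
    (p ℕ.^ e) · 1#              ≈⟨ ·1-homo-^ p e ⟩
    (p · 1#) ^ e                ≈⟨ ^-congˡ e p·1≈0 ⟩
    0# ^ e                      ≈⟨ 0^≈0 e>0 ⟩
    0#                          ∎)

  frobenius : OrderFiveAutomorphism
  frobenius = record
    { σ                   = _^ Q
    ; σ-cong              = ^-congˡ Q
    ; σ-+                 = λ x y → ≡.subst (λ q → (x + y) ^ q ≈ x ^ q + y ^ q) p^e≡1+5t (^pʲ-distrib-+ p-prime p·1≈0 e x y)
    ; σ-*                 = λ x y → ^-distrib-* x y Q
    ; σ⁵≈id               = ^Q⁵≈id
    ; σ-fixes-fifth-roots = λ {u} u^5≈1 → trans (*-congˡ (trans (sym (^-assocʳ u 5 t)) (trans (^-congˡ t u^5≈1) (1^ t)))) (*-identityʳ u)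
    }
    where
    ^Q⁵≈id : ∀ x → ((((x ^ Q) ^ Q) ^ Q) ^ Q) ^ Q ≈ x
    ^Q⁵≈id x = begin
      ((((x ^ Q) ^ Q) ^ Q) ^ Q) ^ Q       ≈⟨ ^-assocʳ (((x ^ Q) ^ Q) ^ Q) Q Q ⟩
      (((x ^ Q) ^ Q) ^ Q) ^ (Q ℕ.* Q)     ≈⟨ ^-assocʳ ((x ^ Q) ^ Q) Q (Q ℕ.* Q) ⟩
      ((x ^ Q) ^ Q) ^ (Q ℕ.* (Q ℕ.* Q))   ≈⟨ ^-assocʳ (x ^ Q) Q (Q ℕ.* (Q ℕ.* Q)) ⟩
      (x ^ Q) ^ (Q ℕ.* (Q ℕ.* (Q ℕ.* Q))) ≈⟨ ^-assocʳ x Q (Q ℕ.* (Q ℕ.* (Q ℕ.* Q))) ⟩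
      x ^ (Q ℕ.* (Q ℕ.* (Q ℕ.* (Q ℕ.* Q)))) ≡⟨ ≡.cong (λ q → x ^ (Q ℕ.* (Q ℕ.* (Q ℕ.* (Q ℕ.* q))))) (ℕP.*-identityʳ Q) ⟨
      x ^ (Q ℕ.^ 5)                       ≡⟨ ≡.cong (λ q → x ^ (q ℕ.^ 5)) p^e≡1+5t ⟨
      x ^ ((p ℕ.^ e) ℕ.^ 5)               ≡⟨ ≡.cong (x ^_) size≡[p^e]^5 ⟨
      x ^ size                            ≈⟨ ^size≈id x ⟩
      x                                   ∎

  open OrderFiveAutomorphism frobenius using (σ; σ-cong; σ-*)
  open Decomposition frobenius

  ^k^5t≈^M : ∀ x → (x ^ k) ^ (5 ℕ.* t) ≈ x ^ M
  ^k^5t≈^M x = ^-assocʳ x k (5 ℕ.* t)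

  ^M^5≈1 : ∀ {x} → x ≉ 0# → (x ^ M) ^ 5 ≈ 1#
  ^M^5≈1 {x} x≉0 = trans (^-assocʳ x M 5) (trans (^-congʳ x (≡.sym N≡M*5)) (^N≈1 x≉0))

  ^k-eigenvector : ∀ x → Σ Carrier λ u → u ^ 5 ≈ 1# × σ (x ^ k) ≈ u * x ^ k
  ^k-eigenvector x with x ≟ 0#
  ... | yes x≈0 = 1# , 1^ 5 , trans (^-congˡ Q x^k≈0) (trans (0^≈0 {Q} ℕ.z<s) (sym (trans (*-identityˡ _) x^k≈0)))
    where
    x^k≈0 : x ^ k ≈ 0#
    x^k≈0 = trans (^-congˡ k x≈0) (0^≈0 k>0)
  ... | no x≉0  = (x ^ k) ^ (5 ℕ.* t) , trans (^-congˡ 5 (^k^5t≈^M x)) (^M^5≈1 x≉0) , *-comm _ _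

  M<N : M ℕ.< N
  M<N = ≡.subst (M ℕ.<_) (≡.sym N≡M*5) (ℕP.m<m*n M 5 {{ℕ.>-nonZero M>0}} (ℕ.s≤s (ℕ.s≤s ℕ.z≤n)))

  non-root : Σ Carrier λ x → x ≉ 0# × x ^ M ≉ 1#
  non-root = non-root-exists M M>0 M<N

  x₀ : Carrier
  x₀ = proj₁ non-root

  x₀≉0 : x₀ ≉ 0#
  x₀≉0 = proj₁ (proj₂ non-root)

  x₀^M≉1 : x₀ ^ M ≉ 1#
  x₀^M≉1 = proj₂ (proj₂ non-root)

  ω : Carrier
  ω = x₀ ^ k

  ζ : Carrier
  ζ = ω ^ (5 ℕ.* t)

  ζ^5≈1 : ζ ^ 5 ≈ 1#
  ζ^5≈1 = trans (^-congˡ 5 (^k^5t≈^M x₀)) (^M^5≈1 x₀≉0)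

  ζ≉1 : ζ ≉ 1#
  ζ≉1 ζ≈1 = x₀^M≉1 (trans (sym (^k^5t≈^M x₀)) ζ≈1)

  σ-ω^ : ∀ j → σ (ω ^ j) ≈ ζ ^ j * ω ^ j
  σ-ω^ j = begin
    σ (ω ^ j)       ≈⟨ σ-^ ω j ⟩
    (ω * ζ) ^ j     ≈⟨ ^-distrib-* ω ζ j ⟩
    ω ^ j * ζ ^ j   ≈⟨ *-comm _ _ ⟩
    ζ ^ j * ω ^ j   ∎

  open Spectral ζ^5≈1 ζ≉1 5≉0

  -- σ x unfolds to x * x ^ (5 t).
  σ-fixed⇒^5t≈1 : ∀ {x} → x ≉ 0# → σ x ≈ x → x ^ (5 ℕ.* t) ≈ 1#
  σ-fixed⇒^5t≈1 {x} x≉0 σx≈x = *-cancelˡ x≉0 (trans σx≈x (sym (*-identityʳ x)))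

  -- z / ω ^ j is fixed by σ, hence a (25 t)-th root of unity, hence a k-th power.
  eigenvector-is-^k : ∀ j {z} → σ z ≈ ζ ^ j * z → Σ Carrier λ x → x ^ k ≈ z
  eigenvector-is-^k j {z} σz≈ζ^jz with z ≟ 0#
  ... | yes z≈0 = 0# , trans (0^≈0 k>0) (sym z≈0)
  ... | no z≉0  = s * x₀ ^ j , (begin
    (s * x₀ ^ j) ^ k          ≈⟨ ^-distrib-* s (x₀ ^ j) k ⟩
    s ^ k * (x₀ ^ j) ^ k      ≈⟨ *-cong s^k≈r (^-swap x₀ j k) ⟩
    r * ω ^ j                 ≈⟨ r*ω^j≈z ⟩
    z                         ∎)
    where
    ω^j≉0 : ω ^ j ≉ 0#
    ω^j≉0 = ^-≉0 j (^-≉0 k x₀≉0)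
    ω^-j : Carrier
    ω^-j = proj₁ (inverse (ω ^ j) ω^j≉0)
    r : Carrier
    r = z * ω^-j
    r*ω^j≈z : r * ω ^ j ≈ z
    r*ω^j≈z = trans (solve 3 (λ z w w′ → (z :* w′) :* w := z :* (w :* w′)) refl z (ω ^ j) ω^-j)
                    (trans (*-congˡ (proj₂ (inverse (ω ^ j) ω^j≉0))) (*-identityʳ z))
    r≉0 : r ≉ 0#
    r≉0 r≈0 = z≉0 (trans (sym r*ω^j≈z) (trans (*-congʳ r≈0) (zeroˡ _)))
    σr≈r : σ r ≈ r
    σr≈r = *-cancelˡ (*-≉0 (^-≉0 j (Primitive.ζ≉0 ζ^5≈1 ζ≉1)) ω^j≉0) (begin
      ζ ^ j * ω ^ j * σ r       ≈⟨ *-congʳ (σ-ω^ j) ⟨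
      σ (ω ^ j) * σ r           ≈⟨ σ-* _ _ ⟨
      σ (ω ^ j * r)             ≈⟨ σ-cong (trans (*-comm _ _) r*ω^j≈z) ⟩
      σ z                       ≈⟨ σz≈ζ^jz ⟩
      ζ ^ j * z                 ≈⟨ *-congˡ r*ω^j≈z ⟨
      ζ ^ j * (r * ω ^ j)       ≈⟨ solve 3 (λ a r w → a :* (r :* w) := a :* w :* r) refl (ζ ^ j) r (ω ^ j) ⟩
      ζ ^ j * ω ^ j * r         ∎)
    k*[5t*5]≡N : k ℕ.* (5 ℕ.* t ℕ.* 5) ≡ N
    k*[5t*5]≡N = ≡.trans (≡.sym (ℕP.*-assoc k (5 ℕ.* t) 5)) (≡.sym N≡M*5)
    root : Σ Carrier λ s → s ^ k ≈ r
    root = ^-onto-roots-of-unity k (5 ℕ.* t ℕ.* 5) k*[5t*5]≡N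
             (trans (sym (^-assocʳ r (5 ℕ.* t) 5)) (trans (^-congˡ 5 (σ-fixed⇒^5t≈1 r≉0 σr≈r)) (1^ 5)))
    s : Carrier
    s = proj₁ root
    s^k≈r : s ^ k ≈ r
    s^k≈r = proj₂ root

  waring-rep : WaringRep F k 5
  waring-rep y = (λ j → proj₁ (root j)) , trans (sumF-cong 5 (proj₂ ∘ root)) (sumF-component y)
    where
    root : ∀ j → Σ Carrier λ x → x ^ k ≈ component (toℕ j) y
    root j = eigenvector-is-^k (toℕ j) (σ-component (toℕ j) y)

  no-shorter-rep : ∀ n → 1 ℕ.≤ n → n ℕ.< 5 → ¬ WaringRep F k n
  no-shorter-rep n _ n<5 rep = eigenbasis-resolvent-≉0 (λ i → ω ^ toℕ i) (λ i → ^-≉0 (toℕ i) (^-≉0 k x₀≉0)) (σ-ω^ ∘ toℕ)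
    (proj₁ vanishing) (trans (resolvent-cong _ (sym (proj₂ (rep w)))) (proj₂ vanishing))
    where
    w : Carrier
    w = sumF F 5 (λ i → ω ^ toℕ i)
    vanishing : Σ (Fin 5) λ j → resolvent (ζ ^ toℕ j) (sumF F n (λ i → proj₁ (rep w) i ^ k)) ≈ 0#
    vanishing = short-sum-resolvent-≈0 n<5 (λ i → proj₁ (rep w) i ^ k) (λ i → ^k-eigenvector (proj₁ (rep w) i))

  waring-number : WaringNumberIs F k 5
  waring-number = ℕ.s≤s ℕ.z≤n , waring-rep , no-shorter-rep

waring-number-five : ∀ {c ℓ} (F : FiniteField c ℓ) {p e} → Prime p → 0 ℕ.< e → (p ℕ.^ e) % 5 ≡ 1 →
                     FiniteField.size F ≡ (p ℕ.^ e) ℕ.^ 5 → WaringNumberIs F (Φ₅ℕ (p ℕ.^ e) / 5) 5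
waring-number-five F {p} {e} p-prime e>0 p^e%5≡1 size≡[p^e]^5 =
  FrobeniusWaring.waring-number F {t = p ℕ.^ e / 5} {k = Φ₅ℕ (p ℕ.^ e) / 5} p-prime e>0
    (%5≡1⇒≡1+5*[/5] (p ℕ.^ e) p^e%5≡1) (m*[n/m]≡n (5∣Φ₅ℕ (p ℕ.^ e) p^e%5≡1)) size≡[p^e]^5

^-*-*-assoc : ∀ p c d a → p ℕ.^ (c ℕ.* d ℕ.* a) ≡ (p ℕ.^ (d ℕ.* a)) ℕ.^ c
^-*-*-assoc p c d a = ≡.trans (≡.cong (p ℕ.^_) (≡.trans (ℕP.*-assoc c d a) (ℕP.*-comm c (d ℕ.* a)))) (≡.sym (ℕP.^-*-assoc p (d ℕ.* a) c))

waring-number-five-at-power : ∀ {c ℓ} {p} a d → Prime p → 1 ℕ.≤ a → 1 ℕ.≤ d → (p ℕ.^ d) % 5 ≡ 1 →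
  (F : FiniteField c ℓ) → FiniteField.size F ≡ p ℕ.^ (5 ℕ.* d ℕ.* a) →
  WaringNumberIs F ((p ℕ.^ (4 ℕ.* d ℕ.* a) ℕ.+ p ℕ.^ (3 ℕ.* d ℕ.* a) ℕ.+ p ℕ.^ (2 ℕ.* d ℕ.* a) ℕ.+ p ℕ.^ (d ℕ.* a) ℕ.+ 1) / 5) 5
waring-number-five-at-power {p = p} a d p-prime a≥1 d≥1 p^d%5≡1
  rewrite ^-*-*-assoc p 5 d a | ^-*-*-assoc p 4 d a | ^-*-*-assoc p 3 d a | ^-*-*-assoc p 2 d a =
  λ F → waring-number-five F p-prime (ℕP.*-mono-≤ d≥1 a≥1)
          (≡.subst (λ n → n % 5 ≡ 1) (ℕP.^-*-assoc p d a) (%5≡1⇒^%5≡1 (p ℕ.^ d) a p^d%5≡1))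

open import Data.Nat using (ℕ; _+_; _*_; _^_; _≤_)
open import Data.Nat.DivMod using (_/_; _%_)
open import Data.Nat.Primality using (Prime)
open import Data.Product using (_×_)
open import Data.Sum using (_⊎_)
open import Relation.Binary.PropositionalEquality using (_≡_)

corollary6p4 : ∀ {c ℓ : Level} (p a : ℕ) → Prime p → 1 ≤ a →
    ((F : FiniteField c ℓ) → FiniteField.size F ≡ p ^ (5 * a) → p % 5 ≡ 1 →
      WaringNumberIs F ((p ^ (4 * a) + p ^ (3 * a) + p ^ (2 * a) + p ^ a + 1) / 5) 5)
    × ((F : FiniteField c ℓ) → FiniteField.size F ≡ p ^ (10 * a) → p % 5 ≡ 4 →
      WaringNumberIs F ((p ^ (8 * a) + p ^ (6 * a) + p ^ (4 * a) + p ^ (2 * a) + 1) / 5) 5)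
    × ((F : FiniteField c ℓ) → FiniteField.size F ≡ p ^ (20 * a) → (p % 5 ≡ 2 ⊎ p % 5 ≡ 3) →
      WaringNumberIs F ((p ^ (16 * a) + p ^ (12 * a) + p ^ (8 * a) + p ^ (4 * a) + 1) / 5) 5)
corollary6p4 p a p-prime a≥1 =
    (λ F size≡ p%5≡1 → ≡.subst (λ e → WaringNumberIs F ((p ^ (4 * a) + p ^ (3 * a) + p ^ (2 * a) + p ^ e + 1) / 5) 5)
                         (ℕP.*-identityˡ a) (waring-number-five-at-power a 1 p-prime a≥1 ℕP.≤-refl (residue 1 p%5≡1) F size≡))
  , (λ F size≡ p%5≡4 → waring-number-five-at-power a 2 p-prime a≥1 (ℕ.s≤s ℕ.z≤n) (residue 2 p%5≡4) F size≡)
  , (λ F size≡ p%5≡2∨3 → waring-number-five-at-power a 4 p-prime a≥1 (ℕ.s≤s ℕ.z≤n) ([ residue 4 , residue 4 ] p%5≡2∨3) F size≡)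
  where
  residue : ∀ d {r} → p % 5 ≡ r → (p ^ d) % 5 ≡ (r ^ d) % 5
  residue d p%5≡r = ≡.trans (^-%-congˡ p d 5) (≡.cong (λ r → (r ^ d) % 5) p%5≡r)
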